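{- $\mathsf{WF}\equiv_{sW}\mathsf S_L\equiv_{sW}\mathsf S$.
   Context: $\equiv_{sW}$ denotes strong Weihrauch equivalence. Graphs are countable, given by (characteristic functions of) their vertex and edge sets. $\mathsf{WF}$: given a tree $T\subseteq\mathbb N^{<\mathbb N}$, output $0$ if $T$ contains an infinite path and $1$ if it does not. $\mathsf S$ (isomorphic subgraph): given graphs $G$ and $H$, output $1$ if $H$ is isomorphic to a subgraph of $G$ and $0$ if not. $L$ is the linear graph with vertices $\{v_i:i\in\mathbb N\}$ and edges $\{(v_i,v_{i+1}):i\in\mathbb N\}$. $\mathsf S_L$: given a graph $G$, output $1$ if $L$ is isomorphic to a subgraph of $G$ and $0$ if not. -}

module Defs where

open import Data.Nat using (ℕ; zero; suc; _+_; _*_; _<_; _≤_)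
open import Data.Fin using (Fin)
open import Data.Vec using (Vec; []; _∷_; lookup)
open import Data.List using (List; []; _∷_; _++_; map; upTo)
open import Data.Product using (Σ; _×_; _,_)
open import Data.Sum using (_⊎_)
open import Data.Unit using () renaming (⊤ to ⊤')
open import Relation.Nullary using (¬_)
open import Relation.Binary.PropositionalEquality using (_≡_)

Baire : Set
Baire = ℕ → ℕ

data Code : ℕ → Set where
  zer  : ∀ {n} → Code n
  sucC : Code 1
  proj : ∀ {n} → Fin n → Code n
  orc  : Code 1
  comp : ∀ {m n} → Code m → Vec (Code n) m → Code n
  prec : ∀ {n} → Code n → Code (suc (suc n)) → Code (suc n)
  mu   : ∀ {n} → Code (suc n) → Code n

mutual
  data Eval (α : Baire) : ∀ {n} → Code n → Vec ℕ n → ℕ → Set where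
    ezer   : ∀ {n} {xs : Vec ℕ n} → Eval α zer xs 0
    esuc   : ∀ {x} → Eval α sucC (x ∷ []) (suc x)
    eproj  : ∀ {n} {i : Fin n} {xs} → Eval α (proj i) xs (lookup xs i)
    eorc   : ∀ {x} → Eval α orc (x ∷ []) (α x)
    ecomp  : ∀ {m n} {f : Code m} {gs : Vec (Code n) m} {xs ys z} →
             EvalAll α gs xs ys → Eval α f ys z → Eval α (comp f gs) xs z
    eprec0 : ∀ {n} {g : Code n} {h} {xs z} →
             Eval α g xs z → Eval α (prec g h) (0 ∷ xs) z
    eprecS : ∀ {n} {g : Code n} {h} {k xs z w} →
             Eval α (prec g h) (k ∷ xs) z → Eval α h (k ∷ z ∷ xs) w →
             Eval α (prec g h) (suc k ∷ xs) w
    emu    : ∀ {n} {f : Code (suc n)} {xs k} →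
             Eval α f (k ∷ xs) 0 →
             (∀ j → j < k → Σ ℕ λ m → Eval α f (j ∷ xs) (suc m)) →
             Eval α (mu f) xs k

  data EvalAll (α : Baire) {n : ℕ} : ∀ {m} → Vec (Code n) m → Vec ℕ n → Vec ℕ m → Set where
    []  : ∀ {xs} → EvalAll α [] xs []
    _∷_ : ∀ {m} {g : Code n} {gs : Vec (Code n) m} {xs y ys} →
          Eval α g xs y → EvalAll α gs xs ys → EvalAll α (g ∷ gs) xs (y ∷ ys)

_⟨_⟩↦_ : Code 1 → Baire → Baire → Set
e ⟨ α ⟩↦ β = ∀ n → Eval α e (n ∷ []) (β n)

record Problem : Set₁ where
  field
    Dom : Baire → Set
    Sol : Baire → Baire → Set
open Problem public

_≤sW_ : Problem → Problem → Set
f ≤sW g = Σ (Code 1) λ eΦ → Σ (Code 1) λ eΨ →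
  ∀ p → Dom f p →
    Σ Baire λ q → (eΦ ⟨ p ⟩↦ q) × Dom g q ×
      (∀ r → Sol g q r → Σ Baire λ s → (eΨ ⟨ r ⟩↦ s) × Sol f p s)

_≡sW_ : Problem → Problem → Set
f ≡sW g = (f ≤sW g) × (g ≤sW f)

tri : ℕ → ℕ
tri zero    = zero
tri (suc n) = suc n + tri n

pair : ℕ → ℕ → ℕ
pair x y = tri (x + y) + y

-- coding of finite sequences ℕ^{<ℕ} → ℕ (a bijection)
⌜_⌝ : List ℕ → ℕ
⌜ [] ⌝    = 0
⌜ x ∷ σ ⌝ = suc (pair x ⌜ σ ⌝)

-- even / odd parts of a sequence (coding pairs of sequences)
evens odds : Baire → Baire
evens p n = p (2 * n)
odds  p n = p (suc (2 * n))

Bit : Baire → Set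
Bit p = ∀ n → p n ≤ 1

-- a natural number output b is named by any sequence s with s 0 = b;
-- Answer P₀ P₁ b : b = 0 and P₀ holds, or b = 1 and P₁ holds
Answer : Set → Set → ℕ → Set
Answer P₀ P₁ b = (b ≡ 0 × P₀) ⊎ (b ≡ 1 × P₁)

_∈T_ : List ℕ → Baire → Set
σ ∈T T = T ⌜ σ ⌝ ≡ 1

IsTree : Baire → Set
IsTree T = Bit T × (∀ σ τ → (σ ++ τ) ∈T T → σ ∈T T)

prefix : Baire → ℕ → List ℕ
prefix f n = map f (upTo n)

HasPath : Baire → Set
HasPath T = Σ Baire λ f → ∀ n → prefix f n ∈T T

WF : Problem
WF = record
  { Dom = IsTree
  ; Sol = λ T s → Answer (HasPath T) (¬ HasPath T) (s 0) }

-- Graphs: a graph G is coded by a sequence with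
--   vertex set characteristic function  n ↦ G (2n)
--   edge set characteristic function (a,b) ↦ G (2 ⟨a,b⟩ + 1)

record Graph : Set₁ where
  field
    V : ℕ → Set
    E : ℕ → ℕ → Set
open Graph public

decodeG : Baire → Graph
decodeG G = record
  { V = λ n → evens G n ≡ 1
  ; E = λ a b → odds G (pair a b) ≡ 1 }

IsGraph : Baire → Set
IsGraph G = Bit G ×
  (∀ a b → E (decodeG G) a b → V (decodeG G) a × V (decodeG G) b) ×
  (∀ a b → E (decodeG G) a b → E (decodeG G) b a) ×
  (∀ a → ¬ E (decodeG G) a a)

SubIso : Graph → Graph → Set
SubIso H G = Σ (ℕ → ℕ) λ f →
  (∀ v → V H v → V G (f v)) ×
  (∀ u v → V H u → V H v → f u ≡ f v → u ≡ v) ×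
  (∀ u v → E H u v → E G (f u) (f v))

S : Problem
S = record
  { Dom = λ p → IsGraph (evens p) × IsGraph (odds p)
  ; Sol = λ p s → Answer (¬ SubIso (decodeG (odds p)) (decodeG (evens p))) (SubIso (decodeG (odds p)) (decodeG (evens p))) (s 0) }

L : Graph
L = record
  { V = λ _ → ⊤'
  ; E = λ a b → (b ≡ suc a) ⊎ (a ≡ suc b) }

SL : Problem
SL = record
  { Dom = IsGraph
  ; Sol = λ G s → Answer (¬ SubIso L (decodeG G)) (SubIso L (decodeG G)) (s 0) }

-- WF ≤ SL: a tree T goes to its graph, whose vertices are the codes of the nodes
-- of T and whose edges join each node to its children.  The prefixes of a path
-- through T form a copy of L; conversely an injective ray in this graph eventually
-- runs down a branch of T.  SL ≤ S: pair the input graph with L.  S ≤ WF: the tree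
-- of finite partial embeddings, i.e. of sequences σ such that i ↦ σ i respects the
-- vertices, edges and injectivity for indices below |σ|; its paths are exactly the
-- embeddings of H into G.  The answer is passed on or negated.  All maps are
-- primitive recursive in the input and are written as terms compiled to codes;
-- reductions compose by substituting one code for the oracle of another.
module Submission where

open import Defs
open import Data.Nat
open import Data.Nat.Properties
open import Data.Fin using (Fin; zero; suc)
open import Data.Vec using (Vec; []; _∷_; lookup; tabulate)
open import Data.Vec.Properties using (lookup∘tabulate)
open import Data.List using (List; []; _∷_; length; _++_; map; applyUpTo; upTo; take; drop)
open import Data.List.Properties using (length-map; length-upTo; length-++-≤ˡ; length-take; take++drop≡id)
open import Data.Product using (Σ; _×_; _,_; proj₁; proj₂)
open import Data.Sum using (_⊎_; inj₁; inj₂; reduce) renaming (swap to ⊎-swap; map to ⊎-map)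
open import Data.Empty using (⊥-elim)
open import Data.Unit using (tt)
open import Relation.Nullary using (¬_; yes; no)
open import Relation.Binary.Definitions using (tri<; tri≈; tri>)
open import Relation.Binary.PropositionalEquality

private variable n : ℕ

mutual
  substOracle : Code n → Code 1 → Code n
  substOracle zer         e = zer
  substOracle sucC        e = sucC
  substOracle (proj i)    e = proj i
  substOracle orc         e = e
  substOracle (comp f gs) e = comp (substOracle f e) (substOracleAll gs e)
  substOracle (prec g h)  e = prec (substOracle g e) (substOracle h e)
  substOracle (mu f)      e = mu (substOracle f e)

  substOracleAll : ∀ {m} → Vec (Code n) m → Code 1 → Vec (Code n) m
  substOracleAll []       e = []
  substOracleAll (g ∷ gs) e = substOracle g e ∷ substOracleAll gs e

mutual
  substOracle-eval : ∀ {α β e} {c : Code n} {xs z} →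
    e ⟨ α ⟩↦ β → Eval β c xs z → Eval α (substOracle c e) xs z
  substOracle-eval e↦ ezer         = ezer
  substOracle-eval e↦ esuc         = esuc
  substOracle-eval e↦ eproj        = eproj
  substOracle-eval e↦ (eorc {x})   = e↦ x
  substOracle-eval e↦ (ecomp gs f) = ecomp (substOracleAll-eval e↦ gs) (substOracle-eval e↦ f)
  substOracle-eval e↦ (eprec0 g)   = eprec0 (substOracle-eval e↦ g)
  substOracle-eval e↦ (eprecS r h) = eprecS (substOracle-eval e↦ r) (substOracle-eval e↦ h)
  substOracle-eval e↦ (emu f below) =
    emu (substOracle-eval e↦ f) (λ j j<k → proj₁ (below j j<k) , substOracle-eval e↦ (proj₂ (below j j<k)))

  substOracleAll-eval : ∀ {α β e m} {gs : Vec (Code n) m} {xs ys} →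
    e ⟨ α ⟩↦ β → EvalAll β gs xs ys → EvalAll α (substOracleAll gs e) xs ys
  substOracleAll-eval e↦ []       = []
  substOracleAll-eval e↦ (g ∷ gs) = substOracle-eval e↦ g ∷ substOracleAll-eval e↦ gs

substOracle-computes : ∀ {α β γ e c} → e ⟨ α ⟩↦ β → c ⟨ β ⟩↦ γ → substOracle c e ⟨ α ⟩↦ γ
substOracle-computes e↦ c↦ k = substOracle-eval e↦ (c↦ k)

≤sW-trans : ∀ {f g h} → f ≤sW g → g ≤sW h → f ≤sW h
≤sW-trans (Φ₁ , Ψ₁ , red₁) (Φ₂ , Ψ₂ , red₂) = substOracle Φ₂ Φ₁ , substOracle Ψ₁ Ψ₂ , λ p dp →
  let (q , Φ₁q , dq , back₁) = red₁ p dp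
      (q′ , Φ₂q′ , dq′ , back₂) = red₂ q dq
  in q′ , substOracle-computes Φ₁q Φ₂q′ , dq′ , λ r sr →
     let (s , Ψ₂s , ss) = back₂ r sr
         (s′ , Ψ₁s′ , ss′) = back₁ s ss
     in s′ , substOracle-computes Ψ₂s Ψ₁s′ , ss′

infixl 6 _+ᵗ_ _∸ᵗ_
infixl 7 _*ᵗ_

-- In  rec t b s  the step term s sees the counter as  var zero  and the
-- previous value as  var (suc zero).
data Tm (n : ℕ) : Set where
  var            : Fin n → Tm n
  lit            : ℕ → Tm n
  sucᵗ           : Tm n → Tm n
  _+ᵗ_ _*ᵗ_ _∸ᵗ_ : Tm n → Tm n → Tm n
  oracle         : Tm n → Tm n
  rec            : Tm n → Tm n → Tm (suc (suc n)) → Tm n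

Env : ℕ → Set
Env n = Fin n → ℕ

infixr 5 _∷ᵉ_
_∷ᵉ_ : ℕ → Env n → Env (suc n)
(x ∷ᵉ ρ) zero    = x
(x ∷ᵉ ρ) (suc i) = ρ i

primRec : (ℕ → ℕ → ℕ) → ℕ → ℕ → ℕ
primRec s b zero    = b
primRec s b (suc k) = s k (primRec s b k)

⟦_⟧ : Tm n → Baire → Env n → ℕ
⟦ var i ⟧     α ρ = ρ i
⟦ lit k ⟧     α ρ = k
⟦ sucᵗ t ⟧    α ρ = suc (⟦ t ⟧ α ρ)
⟦ a +ᵗ b ⟧    α ρ = ⟦ a ⟧ α ρ + ⟦ b ⟧ α ρ
⟦ a *ᵗ b ⟧    α ρ = ⟦ a ⟧ α ρ * ⟦ b ⟧ α ρ
⟦ a ∸ᵗ b ⟧    α ρ = ⟦ a ⟧ α ρ ∸ ⟦ b ⟧ α ρ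
⟦ oracle t ⟧  α ρ = α (⟦ t ⟧ α ρ)
⟦ rec t b s ⟧ α ρ = primRec (λ k z → ⟦ s ⟧ α (k ∷ᵉ z ∷ᵉ ρ)) (⟦ b ⟧ α ρ) (⟦ t ⟧ α ρ)

⟦_⟧₁ : Tm 1 → Baire → Baire
⟦ t ⟧₁ α k = ⟦ t ⟧ α (λ _ → k)

litCode : ℕ → Code n
litCode zero    = zer
litCode (suc k) = comp sucC (litCode k ∷ [])

addCode mulCode : Code 2
addCode = prec (proj zero) (comp sucC (proj (suc zero) ∷ []))
mulCode = prec zer (comp addCode (proj (suc (suc zero)) ∷ proj (suc zero) ∷ []))

predCode : Code 1
predCode = prec zer (proj zero)

flippedMonusCode monusCode : Code 2
flippedMonusCode = prec (proj zero) (comp predCode (proj (suc zero) ∷ []))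
monusCode = comp flippedMonusCode (proj (suc zero) ∷ proj zero ∷ [])

compile : Tm n → Code n
compile (var i)     = proj i
compile (lit k)     = litCode k
compile (sucᵗ t)    = comp sucC (compile t ∷ [])
compile (a +ᵗ b)    = comp addCode (compile a ∷ compile b ∷ [])
compile (a *ᵗ b)    = comp mulCode (compile a ∷ compile b ∷ [])
compile (a ∸ᵗ b)    = comp monusCode (compile a ∷ compile b ∷ [])
compile (oracle t)  = comp orc (compile t ∷ [])
compile (rec t b s) = comp (prec (compile b) (compile s)) (compile t ∷ tabulate proj)

module _ {α : Baire} where

  litCode-eval : ∀ k {xs : Vec ℕ n} → Eval α (litCode k) xs k
  litCode-eval zero    = ezer
  litCode-eval (suc k) = ecomp (litCode-eval k ∷ []) esuc

  addCode-eval : ∀ a b → Eval α addCode (a ∷ b ∷ []) (a + b)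
  addCode-eval zero    b = eprec0 eproj
  addCode-eval (suc a) b = eprecS (addCode-eval a b) (ecomp (eproj ∷ []) esuc)

  mulCode-eval : ∀ a b → Eval α mulCode (a ∷ b ∷ []) (a * b)
  mulCode-eval zero    b = eprec0 ezer
  mulCode-eval (suc a) b = eprecS (mulCode-eval a b) (ecomp (eproj ∷ eproj ∷ []) (addCode-eval b (a * b)))

  predCode-eval : ∀ a → Eval α predCode (a ∷ []) (pred a)
  predCode-eval zero    = eprec0 ezer
  predCode-eval (suc a) = eprecS (predCode-eval a) eproj

  flippedMonusCode-eval : ∀ b a → Eval α flippedMonusCode (b ∷ a ∷ []) (a ∸ b)
  flippedMonusCode-eval zero    a = eprec0 eproj
  flippedMonusCode-eval (suc b) a = eprecS (flippedMonusCode-eval b a)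
    (ecomp (eproj ∷ []) (subst (Eval α predCode (a ∸ b ∷ [])) (pred[m∸n]≡m∸[1+n] a b) (predCode-eval (a ∸ b))))

  monusCode-eval : ∀ a b → Eval α monusCode (a ∷ b ∷ []) (a ∸ b)
  monusCode-eval a b = ecomp (eproj ∷ eproj ∷ []) (flippedMonusCode-eval b a)

  prec-eval : ∀ {cb : Code n} {cs ys base step} →
    Eval α cb ys base → (∀ k z → Eval α cs (k ∷ z ∷ ys) (step k z)) →
    ∀ k → Eval α (prec cb cs) (k ∷ ys) (primRec step base k)
  prec-eval eb es zero    = eprec0 eb
  prec-eval eb es (suc k) = eprecS (prec-eval eb es k) (es k _)

  projs-eval : ∀ {m} (f : Fin m → Fin n) (xs : Vec ℕ n) →
    EvalAll α (tabulate (λ i → proj (f i))) xs (tabulate (λ i → lookup xs (f i)))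
  projs-eval {m = zero}  f xs = []
  projs-eval {m = suc m} f xs = eproj ∷ projs-eval (λ i → f (suc i)) xs

  compile-eval : (t : Tm n) (xs : Vec ℕ n) (ρ : Env n) →
    (∀ i → lookup xs i ≡ ρ i) → Eval α (compile t) xs (⟦ t ⟧ α ρ)
  compile-eval (var i)    xs ρ xs≗ρ = subst (Eval α (proj i) xs) (xs≗ρ i) eproj
  compile-eval (lit k)    xs ρ xs≗ρ = litCode-eval k
  compile-eval (sucᵗ t)   xs ρ xs≗ρ = ecomp (compile-eval t xs ρ xs≗ρ ∷ []) esuc
  compile-eval (a +ᵗ b)   xs ρ xs≗ρ =
    ecomp (compile-eval a xs ρ xs≗ρ ∷ compile-eval b xs ρ xs≗ρ ∷ []) (addCode-eval _ _)
  compile-eval (a *ᵗ b)   xs ρ xs≗ρ =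
    ecomp (compile-eval a xs ρ xs≗ρ ∷ compile-eval b xs ρ xs≗ρ ∷ []) (mulCode-eval _ _)
  compile-eval (a ∸ᵗ b)   xs ρ xs≗ρ =
    ecomp (compile-eval a xs ρ xs≗ρ ∷ compile-eval b xs ρ xs≗ρ ∷ []) (monusCode-eval _ _)
  compile-eval (oracle t) xs ρ xs≗ρ = ecomp (compile-eval t xs ρ xs≗ρ ∷ []) eorc
  compile-eval (rec t b s) xs ρ xs≗ρ =
    ecomp (compile-eval t xs ρ xs≗ρ ∷ projs-eval (λ i → i) xs)
      (prec-eval (compile-eval b ys ρ ys≗ρ) (λ k z → compile-eval s (k ∷ z ∷ ys) (k ∷ᵉ z ∷ᵉ ρ) (extended k z))
                 (⟦ t ⟧ α ρ))
    where
    ys = tabulate (lookup xs)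
    ys≗ρ : ∀ i → lookup ys i ≡ ρ i
    ys≗ρ i = trans (lookup∘tabulate (lookup xs) i) (xs≗ρ i)
    extended : ∀ k z i → lookup (k ∷ z ∷ ys) i ≡ (k ∷ᵉ z ∷ᵉ ρ) i
    extended k z zero          = refl
    extended k z (suc zero)    = refl
    extended k z (suc (suc i)) = ys≗ρ i

compile-computes : ∀ t α → compile t ⟨ α ⟩↦ ⟦ t ⟧₁ α
compile-computes t α k = compile-eval t (k ∷ []) (λ _ → k) (λ { zero → refl })

lift₂ : ∀ {m} → (Fin n → Fin m) → Fin (suc (suc n)) → Fin (suc (suc m))
lift₂ r zero          = zero
lift₂ r (suc zero)    = suc zero
lift₂ r (suc (suc i)) = suc (suc (r i))

rename : ∀ {m} → (Fin n → Fin m) → Tm n → Tm m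
rename r (var i)     = var (r i)
rename r (lit k)     = lit k
rename r (sucᵗ t)    = sucᵗ (rename r t)
rename r (a +ᵗ b)    = rename r a +ᵗ rename r b
rename r (a *ᵗ b)    = rename r a *ᵗ rename r b
rename r (a ∸ᵗ b)    = rename r a ∸ᵗ rename r b
rename r (oracle t)  = oracle (rename r t)
rename r (rec t b s) = rec (rename r t) (rename r b) (rename (lift₂ r) s)

primRec-cong : ∀ {s s′ : ℕ → ℕ → ℕ} {b b′} → b ≡ b′ → (∀ k z → s k z ≡ s′ k z) →
  ∀ k → primRec s b k ≡ primRec s′ b′ k
primRec-cong b≡ s≗ zero                  = b≡
primRec-cong {s′ = s′} b≡ s≗ (suc k) = trans (s≗ k _) (cong (s′ k) (primRec-cong b≡ s≗ k))

rename-sem : ∀ {m} (r : Fin n → Fin m) (t : Tm n) α (ρ : Env n) (ρ′ : Env m) →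
  (∀ i → ρ′ (r i) ≡ ρ i) → ⟦ rename r t ⟧ α ρ′ ≡ ⟦ t ⟧ α ρ
rename-sem r (var i)    α ρ ρ′ h = h i
rename-sem r (lit k)    α ρ ρ′ h = refl
rename-sem r (sucᵗ t)   α ρ ρ′ h = cong suc (rename-sem r t α ρ ρ′ h)
rename-sem r (a +ᵗ b)   α ρ ρ′ h = cong₂ _+_ (rename-sem r a α ρ ρ′ h) (rename-sem r b α ρ ρ′ h)
rename-sem r (a *ᵗ b)   α ρ ρ′ h = cong₂ _*_ (rename-sem r a α ρ ρ′ h) (rename-sem r b α ρ ρ′ h)
rename-sem r (a ∸ᵗ b)   α ρ ρ′ h = cong₂ _∸_ (rename-sem r a α ρ ρ′ h) (rename-sem r b α ρ ρ′ h)
rename-sem r (oracle t) α ρ ρ′ h = cong α (rename-sem r t α ρ ρ′ h)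
rename-sem r (rec t b s) α ρ ρ′ h =
  trans (cong (primRec _ _) (rename-sem r t α ρ ρ′ h))
        (primRec-cong (rename-sem r b α ρ ρ′ h)
           (λ k z → rename-sem (lift₂ r) s α (k ∷ᵉ z ∷ᵉ ρ) (k ∷ᵉ z ∷ᵉ ρ′) (lifted k z)) (⟦ t ⟧ α ρ))
  where
  lifted : ∀ k z i → (k ∷ᵉ z ∷ᵉ ρ′) (lift₂ r i) ≡ (k ∷ᵉ z ∷ᵉ ρ) i
  lifted k z zero          = refl
  lifted k z (suc zero)    = refl
  lifted k z (suc (suc i)) = h i

wk : Tm n → Tm (suc n)
wk = rename suc

wk-sem : (t : Tm n) → ∀ α ρ x → ⟦ wk t ⟧ α (x ∷ᵉ ρ) ≡ ⟦ t ⟧ α ρ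
wk-sem t α ρ x = rename-sem suc t α ρ (x ∷ᵉ ρ) (λ i → refl)

wk₂-sem : (t : Tm n) → ∀ α ρ x y → ⟦ wk (wk t) ⟧ α (y ∷ᵉ x ∷ᵉ ρ) ≡ ⟦ t ⟧ α ρ
wk₂-sem t α ρ x y = trans (wk-sem (wk t) α (x ∷ᵉ ρ) y) (wk-sem t α ρ x)

sumBelow prodBelow : ℕ → (ℕ → ℕ) → ℕ
sumBelow zero    g = 0
sumBelow (suc k) g = sumBelow k g + g k
prodBelow zero    g = 1
prodBelow (suc k) g = prodBelow k g * g k

sumBelow-cong : ∀ {g h} → (∀ i → g i ≡ h i) → ∀ k → sumBelow k g ≡ sumBelow k h
sumBelow-cong g≗h zero    = refl
sumBelow-cong g≗h (suc k) = cong₂ _+_ (sumBelow-cong g≗h k) (g≗h k)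

prodBelow-cong : ∀ {g h} → (∀ i → g i ≡ h i) → ∀ k → prodBelow k g ≡ prodBelow k h
prodBelow-cong g≗h zero    = refl
prodBelow-cong g≗h (suc k) = cong₂ _*_ (prodBelow-cong g≗h k) (g≗h k)

sumBelow-threshold : ∀ {g} d → (∀ s → s < d → g s ≡ 1) → (∀ s → d ≤ s → g s ≡ 0) →
  ∀ m → sumBelow m g ≡ m ⊓ d
sumBelow-threshold d below above zero = refl
sumBelow-threshold {g} d below above (suc m) with m <? d
... | yes m<d = begin
  sumBelow m g + g m ≡⟨ cong₂ _+_ (sumBelow-threshold d below above m) (below m m<d) ⟩
  m ⊓ d + 1          ≡⟨ cong (_+ 1) (m≤n⇒m⊓n≡m (<⇒≤ m<d)) ⟩
  m + 1              ≡⟨ +-comm m 1 ⟩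
  suc m              ≡⟨ m≤n⇒m⊓n≡m m<d ⟨
  suc m ⊓ d          ∎ where open ≡-Reasoning
... | no m≮d = begin
  sumBelow m g + g m ≡⟨ cong₂ _+_ (sumBelow-threshold d below above m) (above m d≤m) ⟩
  m ⊓ d + 0          ≡⟨ +-identityʳ _ ⟩
  m ⊓ d              ≡⟨ m≥n⇒m⊓n≡n d≤m ⟩
  d                  ≡⟨ m≥n⇒m⊓n≡n (m≤n⇒m≤1+n d≤m) ⟨
  suc m ⊓ d          ∎
  where
  open ≡-Reasoning
  d≤m = ≮⇒≥ m≮d

sumBelow-threshold-≥ : ∀ {g} d m → (∀ s → s < d → g s ≡ 1) → (∀ s → d ≤ s → g s ≡ 0) →
  d ≤ m → sumBelow m g ≡ d
sumBelow-threshold-≥ d m below above d≤m = trans (sumBelow-threshold d below above m) (m≥n⇒m⊓n≡n d≤m)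

prodBelow≡1⇒ : ∀ {g} k → prodBelow k g ≡ 1 → ∀ i → i < k → g i ≡ 1
prodBelow≡1⇒ {g} (suc k) prod≡1 i i<1+k with m≤n⇒m<n∨m≡n (s≤s⁻¹ i<1+k)
... | inj₁ i<k  = prodBelow≡1⇒ k (m*n≡1⇒m≡1 _ _ prod≡1) i i<k
... | inj₂ refl = m*n≡1⇒n≡1 (prodBelow k g) _ prod≡1

prodBelow≡1⇐ : ∀ {g} k → (∀ i → i < k → g i ≡ 1) → prodBelow k g ≡ 1
prodBelow≡1⇐ zero    all≡1 = refl
prodBelow≡1⇐ (suc k) all≡1 = cong₂ _*_ (prodBelow≡1⇐ k (λ i i<k → all≡1 i (m≤n⇒m≤1+n i<k))) (all≡1 k ≤-refl)

prodBelow≤1 : ∀ {g} k → (∀ i → g i ≤ 1) → prodBelow k g ≤ 1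
prodBelow≤1 zero    bits = ≤-refl
prodBelow≤1 (suc k) bits = *-mono-≤ (prodBelow≤1 k bits) (bits k)

bit-cases : ∀ {b} → b ≤ 1 → b ≡ 0 ⊎ b ≡ 1
bit-cases z≤n       = inj₁ refl
bit-cases (s≤s z≤n) = inj₂ refl

leBit eqBit orBit impBit : ℕ → ℕ → ℕ
leBit a b  = 1 ∸ (a ∸ b)
eqBit a b  = leBit a b * leBit b a
orBit x y  = leBit 1 (x + y)
impBit x y = 1 ∸ x * (1 ∸ y)

leBit≤1 : ∀ a b → leBit a b ≤ 1
leBit≤1 a b = m∸n≤m 1 (a ∸ b)

leBit≡1⇐ : ∀ {a b} → a ≤ b → leBit a b ≡ 1
leBit≡1⇐ a≤b = cong (1 ∸_) (m≤n⇒m∸n≡0 a≤b)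

leBit≡0⇐ : ∀ {a b} → b < a → leBit a b ≡ 0
leBit≡0⇐ b<a = m≤n⇒m∸n≡0 (m<n⇒0<n∸m b<a)

leBit≡1⇒ : ∀ a b → leBit a b ≡ 1 → a ≤ b
leBit≡1⇒ a b le≡1 with a ≤? b
... | yes a≤b = a≤b
... | no  a≰b = ⊥-elim (1+n≢0 (trans (sym le≡1) (leBit≡0⇐ (≰⇒> a≰b))))

eqBit≤1 : ∀ a b → eqBit a b ≤ 1
eqBit≤1 a b = *-mono-≤ (leBit≤1 a b) (leBit≤1 b a)

eqBit≡1⇐ : ∀ {a b} → a ≡ b → eqBit a b ≡ 1
eqBit≡1⇐ {a} refl = cong₂ _*_ (leBit≡1⇐ (≤-refl {a})) (leBit≡1⇐ (≤-refl {a}))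

eqBit≡1⇒ : ∀ a b → eqBit a b ≡ 1 → a ≡ b
eqBit≡1⇒ a b eq≡1 = ≤-antisym (leBit≡1⇒ a b (m*n≡1⇒m≡1 (leBit a b) (leBit b a) eq≡1))
                              (leBit≡1⇒ b a (m*n≡1⇒n≡1 (leBit a b) (leBit b a) eq≡1))

orBit≤1 : ∀ x y → orBit x y ≤ 1
orBit≤1 x y = leBit≤1 1 (x + y)

orBit≡1⇒ : ∀ {x y} → x ≤ 1 → y ≤ 1 → orBit x y ≡ 1 → x ≡ 1 ⊎ y ≡ 1
orBit≡1⇒ x≤1 y≤1 or≡1 with bit-cases x≤1 | bit-cases y≤1
... | inj₂ x≡1  | _         = inj₁ x≡1
... | _         | inj₂ y≡1  = inj₂ y≡1
... | inj₁ refl | inj₁ refl = ⊥-elim (1+n≢0 (sym or≡1))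

orBit≡1⇐ : ∀ {x y} → x ≡ 1 ⊎ y ≡ 1 → orBit x y ≡ 1
orBit≡1⇐ {y = y} (inj₁ refl) = leBit≡1⇐ {1} {1 + y} (s≤s z≤n)
orBit≡1⇐ {x = x} (inj₂ refl) = leBit≡1⇐ (m≤n+m 1 x)

impBit≤1 : ∀ x y → impBit x y ≤ 1
impBit≤1 x y = m∸n≤m 1 (x * (1 ∸ y))

impBit≡1⇒ : ∀ {x y} → y ≤ 1 → impBit x y ≡ 1 → x ≡ 1 → y ≡ 1
impBit≡1⇒ y≤1 imp≡1 refl with bit-cases y≤1
... | inj₂ y≡1 = y≡1
... | inj₁ refl = ⊥-elim (1+n≢0 (sym imp≡1))

impBit≡1⇐ : ∀ {x y} → x ≤ 1 → (x ≡ 1 → y ≡ 1) → impBit x y ≡ 1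
impBit≡1⇐ x≤1 x⇒y with bit-cases x≤1
... | inj₁ refl = refl
... | inj₂ refl rewrite x⇒y refl = refl

n≤tri : ∀ n → n ≤ tri n
n≤tri zero    = z≤n
n≤tri (suc n) = m≤m+n (suc n) (tri n)

tri-mono-≤ : ∀ {a b} → a ≤ b → tri a ≤ tri b
tri-mono-≤ {b = zero}        z≤n       = z≤n
tri-mono-≤ {zero}  {suc b}   z≤n       = z≤n
tri-mono-≤ {suc a} {suc b}   (s≤s a≤b) = +-mono-≤ (s≤s a≤b) (tri-mono-≤ a≤b)

OnDiagonal : ℕ → ℕ → Set
OnDiagonal m d = tri d ≤ m × m < tri (suc d)

onDiagonal-exists : ∀ m → Σ ℕ (OnDiagonal m)
onDiagonal-exists zero = 0 , z≤n , s≤s z≤n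
onDiagonal-exists (suc m) with onDiagonal-exists m
... | d , tri≤m , m<tri with suc m <? tri (suc d)
...   | yes 1+m<tri = d , m≤n⇒m≤1+n tri≤m , 1+m<tri
...   | no  1+m≮tri = suc d , ≤-reflexive (sym 1+m≡tri) ,
                      s≤s (subst (_≤ suc d + tri (suc d)) (sym 1+m≡tri) (m≤n+m _ (suc d)))
  where
  1+m≡tri : suc m ≡ tri (suc d)
  1+m≡tri = ≤-antisym m<tri (≮⇒≥ 1+m≮tri)

onDiagonal-unique : ∀ {m d d′} → OnDiagonal m d → OnDiagonal m d′ → d ≡ d′
onDiagonal-unique {m} {d} {d′} (tri≤m , m<tri) (tri≤m′ , m<tri′) with <-cmp d d′
... | tri≈ _ d≡d′ _ = d≡d′
... | tri< d<d′ _ _ = ⊥-elim (<-irrefl refl (<-≤-trans m<tri (≤-trans (tri-mono-≤ d<d′) tri≤m′)))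
... | tri> _ _ d>d′ = ⊥-elim (<-irrefl refl (<-≤-trans m<tri′ (≤-trans (tri-mono-≤ d>d′) tri≤m)))

diagonal : ℕ → ℕ
diagonal m = sumBelow m (λ s → leBit (tri (suc s)) m)

diagonal-onDiagonal : ∀ m → OnDiagonal m (diagonal m)
diagonal-onDiagonal m with onDiagonal-exists m
... | d , tri≤m , m<tri = subst (OnDiagonal m) (sym diagonal≡d) (tri≤m , m<tri)
  where
  diagonal≡d : diagonal m ≡ d
  diagonal≡d = sumBelow-threshold-≥ d m
    (λ s s<d → leBit≡1⇐ (≤-trans (tri-mono-≤ s<d) tri≤m))
    (λ s d≤s → leBit≡0⇐ (<-≤-trans m<tri (tri-mono-≤ (s≤s d≤s))))
    (≤-trans (n≤tri d) tri≤m)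

unpair₁ unpair₂ : ℕ → ℕ
unpair₂ m = m ∸ tri (diagonal m)
unpair₁ m = diagonal m ∸ unpair₂ m

pair-onDiagonal : ∀ x y → OnDiagonal (pair x y) (x + y)
pair-onDiagonal x y = m≤m+n _ y ,
  subst (_< tri (suc (x + y))) (+-comm y (tri (x + y))) (+-monoˡ-< (tri (x + y)) (s≤s (m≤n+m y x)))

diagonal-pair : ∀ x y → diagonal (pair x y) ≡ x + y
diagonal-pair x y = onDiagonal-unique (diagonal-onDiagonal (pair x y)) (pair-onDiagonal x y)

unpair₂-pair : ∀ x y → unpair₂ (pair x y) ≡ y
unpair₂-pair x y = trans (cong (λ d → pair x y ∸ tri d) (diagonal-pair x y)) (m+n∸m≡n (tri (x + y)) y)

unpair₁-pair : ∀ x y → unpair₁ (pair x y) ≡ x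
unpair₁-pair x y = trans (cong₂ _∸_ (diagonal-pair x y) (unpair₂-pair x y)) (m+n∸n≡m x y)

unpair₂≤ : ∀ m → unpair₂ m ≤ m
unpair₂≤ m = m∸n≤m m (tri (diagonal m))

unpair₂≤diagonal : ∀ m → unpair₂ m ≤ diagonal m
unpair₂≤diagonal m = s≤s⁻¹ (m<n+o⇒m∸n<o m (tri d) (subst (m <_) (+-comm (suc d) (tri d)) m<tri))
  where
  d = diagonal m
  m<tri = proj₂ (diagonal-onDiagonal m)

pair-unpair : ∀ m → pair (unpair₁ m) (unpair₂ m) ≡ m
pair-unpair m = begin
  tri (unpair₁ m + unpair₂ m) + unpair₂ m   ≡⟨ cong (λ w → tri w + unpair₂ m) (m∸n+n≡m (unpair₂≤diagonal m)) ⟩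
  tri (diagonal m) + (m ∸ tri (diagonal m)) ≡⟨ m+[n∸m]≡n (proj₁ (diagonal-onDiagonal m)) ⟩
  m                                         ∎ where open ≡-Reasoning

nth : List ℕ → ℕ → ℕ
nth []      i       = 0
nth (x ∷ σ) zero    = x
nth (x ∷ σ) (suc i) = nth σ i

codeHead codeTail : ℕ → ℕ
codeHead c = unpair₁ (c ∸ 1)
codeTail c = unpair₂ (c ∸ 1)

codeDrop : ℕ → ℕ → ℕ
codeDrop zero    c = c
codeDrop (suc i) c = codeTail (codeDrop i c)

codeLength : ℕ → ℕ
codeLength c = sumBelow c (λ i → 1 ∸ (1 ∸ codeDrop i c))

codeNth : ℕ → ℕ → ℕ
codeNth c i = codeHead (codeDrop i c)

codeHead-∷ : ∀ x σ → codeHead ⌜ x ∷ σ ⌝ ≡ x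
codeHead-∷ x σ = unpair₁-pair x ⌜ σ ⌝

codeTail-∷ : ∀ x σ → codeTail ⌜ x ∷ σ ⌝ ≡ ⌜ σ ⌝
codeTail-∷ x σ = unpair₂-pair x ⌜ σ ⌝

⌜⌝-injective : ∀ σ τ → ⌜ σ ⌝ ≡ ⌜ τ ⌝ → σ ≡ τ
⌜⌝-injective []      []      eq = refl
⌜⌝-injective (x ∷ σ) (y ∷ τ) eq =
  cong₂ _∷_ (trans (sym (codeHead-∷ x σ)) (trans (cong codeHead eq) (codeHead-∷ y τ)))
            (⌜⌝-injective σ τ (trans (sym (codeTail-∷ x σ)) (trans (cong codeTail eq) (codeTail-∷ y τ))))

drop-suc : ∀ i (σ : List ℕ) → drop (suc i) σ ≡ drop 1 (drop i σ)
drop-suc zero    σ       = refl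
drop-suc (suc i) []      = refl
drop-suc (suc i) (x ∷ σ) = drop-suc i σ

codeTail-⌜⌝ : ∀ σ → codeTail ⌜ σ ⌝ ≡ ⌜ drop 1 σ ⌝
codeTail-⌜⌝ []      = refl
codeTail-⌜⌝ (x ∷ σ) = codeTail-∷ x σ

codeDrop-⌜⌝ : ∀ i σ → codeDrop i ⌜ σ ⌝ ≡ ⌜ drop i σ ⌝
codeDrop-⌜⌝ zero    σ = refl
codeDrop-⌜⌝ (suc i) σ = begin
  codeTail (codeDrop i ⌜ σ ⌝) ≡⟨ cong codeTail (codeDrop-⌜⌝ i σ) ⟩
  codeTail ⌜ drop i σ ⌝       ≡⟨ codeTail-⌜⌝ (drop i σ) ⟩
  ⌜ drop 1 (drop i σ) ⌝       ≡⟨ cong ⌜_⌝ (drop-suc i σ) ⟨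
  ⌜ drop (suc i) σ ⌝          ∎ where open ≡-Reasoning

codeHead-drop : ∀ i σ → codeHead ⌜ drop i σ ⌝ ≡ nth σ i
codeHead-drop zero    []      = refl
codeHead-drop (suc i) []      = refl
codeHead-drop zero    (x ∷ σ) = codeHead-∷ x σ
codeHead-drop (suc i) (x ∷ σ) = codeHead-drop i σ

codeNth-⌜⌝ : ∀ σ i → codeNth ⌜ σ ⌝ i ≡ nth σ i
codeNth-⌜⌝ σ i = trans (cong codeHead (codeDrop-⌜⌝ i σ)) (codeHead-drop i σ)

length≤⌜⌝ : ∀ σ → length σ ≤ ⌜ σ ⌝
length≤⌜⌝ []      = z≤n
length≤⌜⌝ (x ∷ σ) = s≤s (≤-trans (length≤⌜⌝ σ) (m≤n+m _ _))

⌜drop⌝-nonZero : ∀ i σ → i < length σ → 1 ∸ (1 ∸ ⌜ drop i σ ⌝) ≡ 1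
⌜drop⌝-nonZero zero    (x ∷ σ) _         = cong (1 ∸_) (0∸n≡0 (pair x ⌜ σ ⌝))
⌜drop⌝-nonZero (suc i) (x ∷ σ) (s≤s i<n) = ⌜drop⌝-nonZero i σ i<n

⌜drop⌝-zero : ∀ i σ → length σ ≤ i → ⌜ drop i σ ⌝ ≡ 0
⌜drop⌝-zero zero    []      _         = refl
⌜drop⌝-zero (suc i) []      _         = refl
⌜drop⌝-zero (suc i) (x ∷ σ) (s≤s n≤i) = ⌜drop⌝-zero i σ n≤i

codeLength-⌜⌝ : ∀ σ → codeLength ⌜ σ ⌝ ≡ length σ
codeLength-⌜⌝ σ = sumBelow-threshold-≥ (length σ) ⌜ σ ⌝
  (λ s s<n → trans (cong (λ w → 1 ∸ (1 ∸ w)) (codeDrop-⌜⌝ s σ)) (⌜drop⌝-nonZero s σ s<n))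
  (λ s n≤s → cong (λ w → 1 ∸ (1 ∸ w)) (trans (codeDrop-⌜⌝ s σ) (⌜drop⌝-zero s σ n≤s)))
  (length≤⌜⌝ σ)

decodeWithFuel : ℕ → ℕ → List ℕ
decodeWithFuel f       zero    = []
decodeWithFuel zero    (suc c) = []
decodeWithFuel (suc f) (suc c) = unpair₁ c ∷ decodeWithFuel f (unpair₂ c)

⌜decodeWithFuel⌝ : ∀ f c → c ≤ f → ⌜ decodeWithFuel f c ⌝ ≡ c
⌜decodeWithFuel⌝ f       zero    c≤f       = refl
⌜decodeWithFuel⌝ (suc f) (suc c) (s≤s c≤f) = cong suc (trans
  (cong (pair (unpair₁ c)) (⌜decodeWithFuel⌝ f (unpair₂ c) (≤-trans (unpair₂≤ c) c≤f)))
  (pair-unpair c))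

decode : ℕ → List ℕ
decode c = decodeWithFuel c c

⌜decode⌝ : ∀ c → ⌜ decode c ⌝ ≡ c
⌜decode⌝ c = ⌜decodeWithFuel⌝ c c ≤-refl

decode-injective : ∀ a b → decode a ≡ decode b → a ≡ b
decode-injective a b eq = trans (sym (⌜decode⌝ a)) (trans (cong ⌜_⌝ eq) (⌜decode⌝ b))

nth-map-applyUpTo : ∀ (f g : ℕ → ℕ) m i → i < m → nth (map f (applyUpTo g m)) i ≡ f (g i)
nth-map-applyUpTo f g (suc m) zero    i<m       = refl
nth-map-applyUpTo f g (suc m) (suc i) (s≤s i<m) = nth-map-applyUpTo f (λ k → g (suc k)) m i i<m

nth-prefix : ∀ f m i → i < m → nth (prefix f m) i ≡ f i
nth-prefix f = nth-map-applyUpTo f (λ k → k)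

length-prefix : ∀ f m → length (prefix f m) ≡ m
length-prefix f m = trans (length-map f (upTo m)) (length-upTo m)

nth-++ : ∀ σ τ i → i < length σ → nth (σ ++ τ) i ≡ nth σ i
nth-++ (x ∷ σ) τ zero    i<n       = refl
nth-++ (x ∷ σ) τ (suc i) (s≤s i<n) = nth-++ σ τ i i<n

nth-take : ∀ m (σ : List ℕ) i → i < m → nth (take m σ) i ≡ nth σ i
nth-take (suc m) []      i       i<m       = refl
nth-take (suc m) (x ∷ σ) zero    i<m       = refl
nth-take (suc m) (x ∷ σ) (suc i) (s≤s i<m) = nth-take m σ i i<m

nth-ext : ∀ (σ τ : List ℕ) → length σ ≡ length τ → (∀ i → i < length σ → nth σ i ≡ nth τ i) → σ ≡ τ
nth-ext []      []      _     _   = refl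
nth-ext (x ∷ σ) (y ∷ τ) |σ|≡|τ| σ≗τ =
  cong₂ _∷_ (σ≗τ 0 z<s) (nth-ext σ τ (suc-injective |σ|≡|τ|) (λ i i<n → σ≗τ (suc i) (s≤s i<n)))

skipAccumulator : Fin (suc n) → Fin (suc (suc n))
skipAccumulator zero    = zero
skipAccumulator (suc i) = suc (suc i)

sumᵗ prodᵗ : Tm n → Tm (suc n) → Tm n
sumᵗ  t body = rec t (lit 0) (var (suc zero) +ᵗ rename skipAccumulator body)
prodᵗ t body = rec t (lit 1) (var (suc zero) *ᵗ rename skipAccumulator body)

skipAccumulator-env : ∀ (ρ : Env n) k z i → (k ∷ᵉ z ∷ᵉ ρ) (skipAccumulator i) ≡ (k ∷ᵉ ρ) i
skipAccumulator-env ρ k z zero    = refl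
skipAccumulator-env ρ k z (suc i) = refl

sumᵗ-sem : ∀ (t : Tm n) body α ρ →
  ⟦ sumᵗ t body ⟧ α ρ ≡ sumBelow (⟦ t ⟧ α ρ) (λ i → ⟦ body ⟧ α (i ∷ᵉ ρ))
sumᵗ-sem t body α ρ = go (⟦ t ⟧ α ρ)
  where
  go : ∀ k → ⟦ rec (lit k) (lit 0) (var (suc zero) +ᵗ rename skipAccumulator body) ⟧ α ρ
           ≡ sumBelow k (λ i → ⟦ body ⟧ α (i ∷ᵉ ρ))
  go zero    = refl
  go (suc k) = cong₂ _+_ (go k) (rename-sem skipAccumulator body α (k ∷ᵉ ρ) _ (skipAccumulator-env ρ k _))

prodᵗ-sem : ∀ (t : Tm n) body α ρ →
  ⟦ prodᵗ t body ⟧ α ρ ≡ prodBelow (⟦ t ⟧ α ρ) (λ i → ⟦ body ⟧ α (i ∷ᵉ ρ))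
prodᵗ-sem t body α ρ = go (⟦ t ⟧ α ρ)
  where
  go : ∀ k → ⟦ rec (lit k) (lit 1) (var (suc zero) *ᵗ rename skipAccumulator body) ⟧ α ρ
           ≡ prodBelow k (λ i → ⟦ body ⟧ α (i ∷ᵉ ρ))
  go zero    = refl
  go (suc k) = cong₂ _*_ (go k) (rename-sem skipAccumulator body α (k ∷ᵉ ρ) _ (skipAccumulator-env ρ k _))

leBitᵗ eqBitᵗ orBitᵗ impBitᵗ : Tm n → Tm n → Tm n
leBitᵗ a b  = lit 1 ∸ᵗ (a ∸ᵗ b)
eqBitᵗ a b  = leBitᵗ a b *ᵗ leBitᵗ b a
orBitᵗ x y  = leBitᵗ (lit 1) (x +ᵗ y)
impBitᵗ x y = lit 1 ∸ᵗ x *ᵗ (lit 1 ∸ᵗ y)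

triᵗ : Tm n → Tm n
triᵗ u = rec u (lit 0) (sucᵗ (var zero) +ᵗ var (suc zero))

triᵗ-sem : ∀ (u : Tm n) α ρ → ⟦ triᵗ u ⟧ α ρ ≡ tri (⟦ u ⟧ α ρ)
triᵗ-sem u α ρ = go (⟦ u ⟧ α ρ)
  where
  go : ∀ k → primRec (λ k z → suc k + z) 0 k ≡ tri k
  go zero    = refl
  go (suc k) = cong (suc k +_) (go k)

pairᵗ : Tm n → Tm n → Tm n
pairᵗ x y = triᵗ (x +ᵗ y) +ᵗ y

pairᵗ-sem : ∀ (x y : Tm n) α ρ → ⟦ pairᵗ x y ⟧ α ρ ≡ pair (⟦ x ⟧ α ρ) (⟦ y ⟧ α ρ)
pairᵗ-sem x y α ρ = cong (_+ ⟦ y ⟧ α ρ) (triᵗ-sem (x +ᵗ y) α ρ)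

diagonalᵗ : Tm n → Tm n
diagonalᵗ u = sumᵗ u (leBitᵗ (triᵗ (sucᵗ (var zero))) (wk u))

diagonalᵗ-sem : ∀ (u : Tm n) α ρ → ⟦ diagonalᵗ u ⟧ α ρ ≡ diagonal (⟦ u ⟧ α ρ)
diagonalᵗ-sem u α ρ = trans (sumᵗ-sem u (leBitᵗ (triᵗ (sucᵗ (var zero))) (wk u)) α ρ) (sumBelow-cong
  (λ i → cong₂ leBit (triᵗ-sem (sucᵗ (var zero)) α (i ∷ᵉ ρ)) (wk-sem u α ρ i)) (⟦ u ⟧ α ρ))

unpair₁ᵗ unpair₂ᵗ : Tm n → Tm n
unpair₂ᵗ u = u ∸ᵗ triᵗ (diagonalᵗ u)
unpair₁ᵗ u = diagonalᵗ u ∸ᵗ unpair₂ᵗ u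

unpair₂ᵗ-sem : ∀ (u : Tm n) α ρ → ⟦ unpair₂ᵗ u ⟧ α ρ ≡ unpair₂ (⟦ u ⟧ α ρ)
unpair₂ᵗ-sem u α ρ = cong (⟦ u ⟧ α ρ ∸_) (trans (triᵗ-sem (diagonalᵗ u) α ρ) (cong tri (diagonalᵗ-sem u α ρ)))

unpair₁ᵗ-sem : ∀ (u : Tm n) α ρ → ⟦ unpair₁ᵗ u ⟧ α ρ ≡ unpair₁ (⟦ u ⟧ α ρ)
unpair₁ᵗ-sem u α ρ = cong₂ _∸_ (diagonalᵗ-sem u α ρ) (unpair₂ᵗ-sem u α ρ)

codeHeadᵗ codeTailᵗ : Tm n → Tm n
codeHeadᵗ u = unpair₁ᵗ (u ∸ᵗ lit 1)
codeTailᵗ u = unpair₂ᵗ (u ∸ᵗ lit 1)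

codeDropᵗ : Tm n → Tm n → Tm n
codeDropᵗ i u = rec i u (codeTailᵗ (var (suc zero)))

codeDropᵗ-sem : ∀ (i u : Tm n) α ρ → ⟦ codeDropᵗ i u ⟧ α ρ ≡ codeDrop (⟦ i ⟧ α ρ) (⟦ u ⟧ α ρ)
codeDropᵗ-sem i u α ρ = go (⟦ i ⟧ α ρ)
  where
  go : ∀ k → ⟦ codeDropᵗ (lit k) u ⟧ α ρ ≡ codeDrop k (⟦ u ⟧ α ρ)
  go zero    = refl
  go (suc k) = trans (unpair₂ᵗ-sem (var (suc zero) ∸ᵗ lit 1) α (k ∷ᵉ ⟦ codeDropᵗ (lit k) u ⟧ α ρ ∷ᵉ ρ))
                     (cong codeTail (go k))

codeLengthᵗ : Tm n → Tm n
codeLengthᵗ u = sumᵗ u (lit 1 ∸ᵗ (lit 1 ∸ᵗ codeDropᵗ (var zero) (wk u)))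

codeLengthᵗ-sem : ∀ (u : Tm n) α ρ → ⟦ codeLengthᵗ u ⟧ α ρ ≡ codeLength (⟦ u ⟧ α ρ)
codeLengthᵗ-sem u α ρ = trans (sumᵗ-sem u (lit 1 ∸ᵗ (lit 1 ∸ᵗ codeDropᵗ (var zero) (wk u))) α ρ) (sumBelow-cong
  (λ i → cong (λ w → 1 ∸ (1 ∸ w)) (trans (codeDropᵗ-sem (var zero) (wk u) α (i ∷ᵉ ρ))
                                         (cong (codeDrop i) (wk-sem u α ρ i))))
  (⟦ u ⟧ α ρ))

codeNthᵗ : Tm n → Tm n → Tm n
codeNthᵗ u i = codeHeadᵗ (codeDropᵗ i u)

codeNthᵗ-sem : ∀ (u i : Tm n) α ρ → ⟦ codeNthᵗ u i ⟧ α ρ ≡ codeNth (⟦ u ⟧ α ρ) (⟦ i ⟧ α ρ)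
codeNthᵗ-sem u i α ρ = trans (unpair₁ᵗ-sem (codeDropᵗ i u ∸ᵗ lit 1) α ρ) (cong codeHead (codeDropᵗ-sem i u α ρ))

prodBelowLengthᵗ-sem : ∀ (u : Tm n) body α ρ →
  ⟦ prodᵗ (codeLengthᵗ u) body ⟧ α ρ ≡ prodBelow (codeLength (⟦ u ⟧ α ρ)) (λ i → ⟦ body ⟧ α (i ∷ᵉ ρ))
prodBelowLengthᵗ-sem u body α ρ =
  trans (prodᵗ-sem (codeLengthᵗ u) body α ρ) (cong (λ l → prodBelow l _) (codeLengthᵗ-sem u α ρ))

parityBit half : ℕ → ℕ
parityBit zero    = 0
parityBit (suc n) = 1 ∸ parityBit n
half zero    = 0
half (suc n) = half n + parityBit n

parityBitᵗ halfᵗ : Tm n → Tm n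
parityBitᵗ u = rec u (lit 0) (lit 1 ∸ᵗ var (suc zero))
halfᵗ u      = rec u (lit 0) (var (suc zero) +ᵗ parityBitᵗ (var zero))

parityBitᵗ-sem : ∀ (u : Tm n) α ρ → ⟦ parityBitᵗ u ⟧ α ρ ≡ parityBit (⟦ u ⟧ α ρ)
parityBitᵗ-sem u α ρ = go (⟦ u ⟧ α ρ)
  where
  go : ∀ k → primRec (λ k z → 1 ∸ z) 0 k ≡ parityBit k
  go zero    = refl
  go (suc k) = cong (1 ∸_) (go k)

halfᵗ-sem : ∀ (u : Tm n) α ρ → ⟦ halfᵗ u ⟧ α ρ ≡ half (⟦ u ⟧ α ρ)
halfᵗ-sem u α ρ = go (⟦ u ⟧ α ρ)
  where
  go : ∀ k → ⟦ halfᵗ (lit k) ⟧ α ρ ≡ half k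
  go zero    = refl
  go (suc k) = cong₂ _+_ (go k) (parityBitᵗ-sem (var zero) α (k ∷ᵉ ⟦ halfᵗ (lit k) ⟧ α ρ ∷ᵉ ρ))

2*-suc : ∀ k → 2 * suc k ≡ suc (suc (2 * k))
2*-suc k = cong suc (+-suc k (k + 0))

parityBit-even : ∀ k → parityBit (2 * k) ≡ 0
parityBit-even zero    = refl
parityBit-even (suc k) = trans (cong parityBit (2*-suc k)) (cong (λ w → 1 ∸ (1 ∸ w)) (parityBit-even k))

parityBit-odd : ∀ k → parityBit (suc (2 * k)) ≡ 1
parityBit-odd k = cong (1 ∸_) (parityBit-even k)

half-even : ∀ k → half (2 * k) ≡ k
half-odd  : ∀ k → half (suc (2 * k)) ≡ k
half-even zero    = refl
half-even (suc k) = trans (cong half (2*-suc k)) (trans (cong₂ _+_ (half-odd k) (parityBit-odd k)) (+-comm k 1))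
half-odd k = trans (cong₂ _+_ (half-even k) (parityBit-even k)) (+-identityʳ k)

even-or-odd : ∀ m → (Σ ℕ λ k → m ≡ 2 * k) ⊎ (Σ ℕ λ k → m ≡ suc (2 * k))
even-or-odd zero = inj₁ (0 , refl)
even-or-odd (suc m) with even-or-odd m
... | inj₁ (k , m≡2k)   = inj₂ (k , cong suc m≡2k)
... | inj₂ (k , m≡2k+1) = inj₁ (suc k , trans (cong suc m≡2k+1) (sym (2*-suc k)))

record Definable : Set₁ where
  field
    fn       : Baire → ℕ → ℕ
    term     : Tm n → Tm n
    term-sem : (u : Tm n) → ∀ α ρ → ⟦ term u ⟧ α ρ ≡ fn α (⟦ u ⟧ α ρ)

  code : Code 1
  code = compile (term (var zero))

  code-computes : ∀ α → code ⟨ α ⟩↦ fn α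
  code-computes α k = subst (Eval α code (k ∷ [])) (term-sem (var zero) α (λ _ → k))
                            (compile-computes (term (var zero)) α k)
open Definable

input : Definable
fn       input α   = α
term     input u   = oracle u
term-sem input u α ρ = refl

constant : ℕ → Definable
fn       (constant c) α _   = c
term     (constant c) u     = lit c
term-sem (constant c) u α ρ = refl

interleave : Definable → Definable → Definable
fn (interleave B C) α k = (1 ∸ parityBit k) * fn B α (half k) + parityBit k * fn C α (half k)
term (interleave B C) u =
  (lit 1 ∸ᵗ parityBitᵗ u) *ᵗ term B (halfᵗ u) +ᵗ parityBitᵗ u *ᵗ term C (halfᵗ u)
term-sem (interleave B C) u α ρ = cong₂ _+_
  (cong₂ _*_ (cong (1 ∸_) (parityBitᵗ-sem u α ρ))
             (trans (term-sem B (halfᵗ u) α ρ) (cong (fn B α) (halfᵗ-sem u α ρ))))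
  (cong₂ _*_ (parityBitᵗ-sem u α ρ)
             (trans (term-sem C (halfᵗ u) α ρ) (cong (fn C α) (halfᵗ-sem u α ρ))))

interleave-even : ∀ B C α k → evens (fn (interleave B C) α) k ≡ fn B α k
interleave-even B C α k rewrite parityBit-even k | half-even k = trans (+-identityʳ _) (+-identityʳ _)

interleave-odd : ∀ B C α k → odds (fn (interleave B C) α) k ≡ fn C α k
interleave-odd B C α k rewrite parityBit-odd k | half-odd k = +-identityʳ _

interleave-bit : ∀ B C α → (∀ k → fn B α k ≤ 1) → (∀ k → fn C α k ≤ 1) → Bit (fn (interleave B C) α)
interleave-bit B C α B≤1 C≤1 m with even-or-odd m
... | inj₁ (k , refl) = subst (_≤ 1) (sym (interleave-even B C α k)) (B≤1 k)
... | inj₂ (k , refl) = subst (_≤ 1) (sym (interleave-odd B C α k)) (C≤1 k)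

negateHead : Code 1
negateHead = compile (lit 1 ∸ᵗ oracle (lit 0))

negateHead-computes : ∀ r → negateHead ⟨ r ⟩↦ (λ _ → 1 ∸ r 0)
negateHead-computes = compile-computes (lit 1 ∸ᵗ oracle (lit 0))

Answer-map : ∀ {A B A′ B′ b} → (A → A′) → (B → B′) → Answer A B b → Answer A′ B′ b
Answer-map f g (inj₁ (b≡0 , a)) = inj₁ (b≡0 , f a)
Answer-map f g (inj₂ (b≡1 , b)) = inj₂ (b≡1 , g b)

Answer-swap : ∀ {A B A′ B′ b} → (A → A′) → (B → B′) → Answer A B b → Answer B′ A′ (1 ∸ b)
Answer-swap f g (inj₁ (refl , a)) = inj₂ (refl , f a)
Answer-swap f g (inj₂ (refl , b)) = inj₁ (refl , g b)

_⊆ᴳ_ : Graph → Graph → Set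
H ⊆ᴳ G = (∀ v → V H v → V G v) × (∀ a b → E H a b → E G a b)

SubIso-mono : ∀ {H H′ G G′} → H′ ⊆ᴳ H → G ⊆ᴳ G′ → SubIso H G → SubIso H′ G′
SubIso-mono (H′⊆H-V , H′⊆H-E) (G⊆G′-V , G⊆G′-E) (f , f-V , f-inj , f-E) =
  f , (λ v v∈H′ → G⊆G′-V _ (f-V v (H′⊆H-V v v∈H′))) ,
  (λ u v u∈H′ v∈H′ → f-inj u v (H′⊆H-V u u∈H′) (H′⊆H-V v v∈H′)) ,
  (λ u v uv∈H′ → G⊆G′-E _ _ (f-E u v (H′⊆H-E u v uv∈H′)))

decodeG-⊆ : ∀ {G G′} → (∀ k → G k ≡ G′ k) → decodeG G ⊆ᴳ decodeG G′
decodeG-⊆ G≗G′ = (λ v v∈G → trans (sym (G≗G′ _)) v∈G) , (λ a b ab∈G → trans (sym (G≗G′ _)) ab∈G)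

IsGraph-cong : ∀ {G G′} → (∀ k → G k ≡ G′ k) → IsGraph G → IsGraph G′
IsGraph-cong {G} {G′} G≗G′ (bits , ends , symm , irrefl) =
  (λ k → subst (_≤ 1) (G≗G′ k) (bits k)) ,
  (λ a b ab → let (a∈G , b∈G) = ends a b (⊆′ .proj₂ a b ab) in ⊆ .proj₁ a a∈G , ⊆ .proj₁ b b∈G) ,
  (λ a b ab → ⊆ .proj₂ b a (symm a b (⊆′ .proj₂ a b ab))) ,
  (λ a aa → irrefl a (⊆′ .proj₂ a a aa))
  where
  ⊆  = decodeG-⊆ {G} {G′} G≗G′
  ⊆′ = decodeG-⊆ {G′} {G} (λ k → sym (G≗G′ k))


adjacentBit : ℕ → ℕ
adjacentBit m = orBit (eqBit (unpair₂ m) (suc (unpair₁ m))) (eqBit (unpair₁ m) (suc (unpair₂ m)))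

adjacentBit≤1 : ∀ m → adjacentBit m ≤ 1
adjacentBit≤1 m = orBit≤1 (eqBit (unpair₂ m) (suc (unpair₁ m))) (eqBit (unpair₁ m) (suc (unpair₂ m)))

adjacent : Definable
fn       adjacent α = adjacentBit
term     adjacent u = orBitᵗ (eqBitᵗ (unpair₂ᵗ u) (sucᵗ (unpair₁ᵗ u))) (eqBitᵗ (unpair₁ᵗ u) (sucᵗ (unpair₂ᵗ u)))
term-sem adjacent u α ρ =
  cong₂ (λ x y → orBit (eqBit y (suc x)) (eqBit x (suc y))) (unpair₁ᵗ-sem u α ρ) (unpair₂ᵗ-sem u α ρ)

adjacentBit-pair : ∀ a b → adjacentBit (pair a b) ≡ orBit (eqBit b (suc a)) (eqBit a (suc b))
adjacentBit-pair a b =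
  cong₂ (λ x y → orBit (eqBit y (suc x)) (eqBit x (suc y))) (unpair₁-pair a b) (unpair₂-pair a b)

adjacentBit≡1⇒ : ∀ a b → adjacentBit (pair a b) ≡ 1 → E L a b
adjacentBit≡1⇒ a b adj≡1 =
  ⊎-map (eqBit≡1⇒ _ _) (eqBit≡1⇒ _ _)
        (orBit≡1⇒ (eqBit≤1 b (suc a)) (eqBit≤1 a (suc b)) (trans (sym (adjacentBit-pair a b)) adj≡1))

adjacentBit≡1⇐ : ∀ a b → E L a b → adjacentBit (pair a b) ≡ 1
adjacentBit≡1⇐ a b ab = trans (adjacentBit-pair a b) (orBit≡1⇐ (⊎-map eqBit≡1⇐ eqBit≡1⇐ ab))

L-irreflexive : ∀ {a} → ¬ E L a a
L-irreflexive (inj₁ a≡1+a) = 1+n≢n (sym a≡1+a)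
L-irreflexive (inj₂ a≡1+a) = 1+n≢n (sym a≡1+a)

lineGraph withLine : Definable
lineGraph = interleave (constant 1) adjacent
withLine  = interleave input lineGraph

module WithLine (G : Baire) where

  q : Baire
  q = fn withLine G

  evens-q : ∀ k → evens q k ≡ G k
  evens-q = interleave-even input lineGraph G

  odds-q : ∀ k → odds q k ≡ fn lineGraph G k
  odds-q = interleave-odd input lineGraph G

  vertex : ∀ v → V (decodeG (odds q)) v
  vertex v = trans (odds-q (2 * v)) (interleave-even (constant 1) adjacent G v)

  edge≡adjacentBit : ∀ a b → odds (odds q) (pair a b) ≡ adjacentBit (pair a b)
  edge≡adjacentBit a b = trans (odds-q (suc (2 * pair a b))) (interleave-odd (constant 1) adjacent G (pair a b))

  L⊆ : L ⊆ᴳ decodeG (odds q)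
  L⊆ = (λ v _ → vertex v) , (λ a b ab → trans (edge≡adjacentBit a b) (adjacentBit≡1⇐ a b ab))

  ⊆L : decodeG (odds q) ⊆ᴳ L
  ⊆L = (λ _ _ → tt) , (λ a b ab → adjacentBit≡1⇒ a b (trans (sym (edge≡adjacentBit a b)) ab))

  isGraph-odds : IsGraph (odds q)
  isGraph-odds =
    (λ k → subst (_≤ 1) (sym (odds-q k))
                 (interleave-bit (constant 1) adjacent G (λ _ → ≤-refl) adjacentBit≤1 k)) ,
    (λ a b _ → vertex a , vertex b) ,
    (λ a b ab → L⊆ .proj₂ b a (⊎-swap (⊆L .proj₂ a b ab))) ,
    (λ a aa → L-irreflexive (⊆L .proj₂ a a aa))

SL≤sWS : SL ≤sW S
SL≤sWS = code withLine , orc , λ G isGraph-G →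
  let open WithLine G in
  q , code-computes withLine G , (IsGraph-cong (λ k → sym (evens-q k)) isGraph-G , isGraph-odds) ,
  λ r answer → r , (λ _ → eorc) ,
    Answer-map (λ ¬iso iso → ¬iso (SubIso-mono ⊆L (decodeG-⊆ (λ k → sym (evens-q k))) iso))
               (SubIso-mono L⊆ (decodeG-⊆ evens-q))
               answer

vertexBit : Baire → ℕ → ℕ
vertexBit G v = eqBit (evens G v) 1

edgeBit : Baire → ℕ → ℕ → ℕ
edgeBit G a b = eqBit (odds G (pair a b)) 1

vertexBit≤1 : ∀ G v → vertexBit G v ≤ 1
vertexBit≤1 G v = eqBit≤1 (evens G v) 1

edgeBit≤1 : ∀ G a b → edgeBit G a b ≤ 1
edgeBit≤1 G a b = eqBit≤1 (odds G (pair a b)) 1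

vertexBit≡1⇒ : ∀ G v → vertexBit G v ≡ 1 → V (decodeG G) v
vertexBit≡1⇒ G v = eqBit≡1⇒ (evens G v) 1

edgeBit≡1⇒ : ∀ G a b → edgeBit G a b ≡ 1 → E (decodeG G) a b
edgeBit≡1⇒ G a b = eqBit≡1⇒ (odds G (pair a b)) 1

compatible : Baire → ℕ → ℕ → ℕ → ℕ → ℕ
compatible p i j a b =
     impBit (vertexBit (odds p) i) (vertexBit (evens p) a)
   * impBit (vertexBit (odds p) i * vertexBit (odds p) j * eqBit a b) (eqBit i j)
   * impBit (edgeBit (odds p) i j) (edgeBit (evens p) a b)

evensᵗ oddsᵗ : (Tm n → Tm n) → Tm n → Tm n
evensᵗ f u = f (lit 2 *ᵗ u)
oddsᵗ  f u = f (sucᵗ (lit 2 *ᵗ u))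

vertexBitᵗ : (Tm n → Tm n) → Tm n → Tm n
vertexBitᵗ f v = eqBitᵗ (evensᵗ f v) (lit 1)

edgeBitᵗ : (Tm n → Tm n) → Tm n → Tm n → Tm n
edgeBitᵗ f a b = eqBitᵗ (oddsᵗ f (pairᵗ a b)) (lit 1)

compatibleᵗ : Tm n → Tm n → Tm n → Tm n → Tm n
compatibleᵗ i j a b =
      impBitᵗ (vertexBitᵗ (oddsᵗ oracle) i) (vertexBitᵗ (evensᵗ oracle) a)
   *ᵗ impBitᵗ (vertexBitᵗ (oddsᵗ oracle) i *ᵗ vertexBitᵗ (oddsᵗ oracle) j *ᵗ eqBitᵗ a b) (eqBitᵗ i j)
   *ᵗ impBitᵗ (edgeBitᵗ (oddsᵗ oracle) i j) (edgeBitᵗ (evensᵗ oracle) a b)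

compatibleᵗ-sem : ∀ (i j a b : Tm n) α ρ →
  ⟦ compatibleᵗ i j a b ⟧ α ρ ≡ compatible α (⟦ i ⟧ α ρ) (⟦ j ⟧ α ρ) (⟦ a ⟧ α ρ) (⟦ b ⟧ α ρ)
compatibleᵗ-sem i j a b α ρ =
  cong₂ (λ x y → vertices * injective * impBit (eqBit (odds (odds α) x) 1) (eqBit (odds (evens α) y) 1))
        (pairᵗ-sem i j α ρ) (pairᵗ-sem a b α ρ)
  where
  i′ = ⟦ i ⟧ α ρ
  j′ = ⟦ j ⟧ α ρ
  a′ = ⟦ a ⟧ α ρ
  b′ = ⟦ b ⟧ α ρ
  vertices  = impBit (vertexBit (odds α) i′) (vertexBit (evens α) a′)
  injective = impBit (vertexBit (odds α) i′ * vertexBit (odds α) j′ * eqBit a′ b′) (eqBit i′ j′)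

compatible≤1 : ∀ p i j a b → compatible p i j a b ≤ 1
compatible≤1 p i j a b = *-mono-≤ (*-mono-≤ (impBit≤1 (vertexBit (odds p) i) (vertexBit (evens p) a))
                                             (impBit≤1 (vertexBit (odds p) i * vertexBit (odds p) j * eqBit a b) (eqBit i j)))
                                   (impBit≤1 (edgeBit (odds p) i j) (edgeBit (evens p) a b))

partialEmbeddingBit : Baire → ℕ → ℕ
partialEmbeddingBit p c =
  prodBelow (codeLength c) (λ i → prodBelow (codeLength c) (λ j → compatible p i j (codeNth c i) (codeNth c j)))

partialEmbeddingBit≤1 : ∀ p c → partialEmbeddingBit p c ≤ 1
partialEmbeddingBit≤1 p c =
  prodBelow≤1 (codeLength c) (λ i → prodBelow≤1 (codeLength c) (λ j → compatible≤1 p i j (codeNth c i) (codeNth c j)))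

partialEmbeddingEntryᵗ : Tm n → Tm (suc (suc n))
partialEmbeddingEntryᵗ c = compatibleᵗ (var (suc zero)) (var zero)
                                       (codeNthᵗ (wk (wk c)) (var (suc zero))) (codeNthᵗ (wk (wk c)) (var zero))

partialEmbeddingTree : Definable
fn   partialEmbeddingTree = partialEmbeddingBit
term partialEmbeddingTree c = prodᵗ (codeLengthᵗ c) (prodᵗ (codeLengthᵗ (wk c)) (partialEmbeddingEntryᵗ c))
term-sem partialEmbeddingTree c α ρ =
  trans (prodBelowLengthᵗ-sem c (prodᵗ (codeLengthᵗ (wk c)) (partialEmbeddingEntryᵗ c)) α ρ) (prodBelow-cong row (codeLength C))
  where
  C = ⟦ c ⟧ α ρ
  nthᵗ-sem : ∀ i j x → ⟦ codeNthᵗ (wk (wk c)) x ⟧ α (j ∷ᵉ i ∷ᵉ ρ) ≡ codeNth C (⟦ x ⟧ α (j ∷ᵉ i ∷ᵉ ρ))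
  nthᵗ-sem i j x = trans (codeNthᵗ-sem (wk (wk c)) x α (j ∷ᵉ i ∷ᵉ ρ))
                         (cong (λ w → codeNth w (⟦ x ⟧ α (j ∷ᵉ i ∷ᵉ ρ))) (wk₂-sem c α ρ i j))
  entry-sem : ∀ i j → ⟦ partialEmbeddingEntryᵗ c ⟧ α (j ∷ᵉ i ∷ᵉ ρ) ≡ compatible α i j (codeNth C i) (codeNth C j)
  entry-sem i j = trans (compatibleᵗ-sem (var (suc zero)) (var zero) (codeNthᵗ (wk (wk c)) (var (suc zero)))
                                                (codeNthᵗ (wk (wk c)) (var zero)) α (j ∷ᵉ i ∷ᵉ ρ))
                        (cong₂ (compatible α i j) (nthᵗ-sem i j (var (suc zero))) (nthᵗ-sem i j (var zero)))
  row : ∀ i → ⟦ prodᵗ (codeLengthᵗ (wk c)) (partialEmbeddingEntryᵗ c) ⟧ α (i ∷ᵉ ρ)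
            ≡ prodBelow (codeLength C) (λ j → compatible α i j (codeNth C i) (codeNth C j))
  row i = trans (prodBelowLengthᵗ-sem (wk c) (partialEmbeddingEntryᵗ c) α (i ∷ᵉ ρ))
                (trans (cong (λ w → prodBelow (codeLength w) (λ j → ⟦ partialEmbeddingEntryᵗ c ⟧ α (j ∷ᵉ i ∷ᵉ ρ)))
                             (wk-sem c α ρ i))
                       (prodBelow-cong (entry-sem i) (codeLength C)))

PartialEmbedding : Baire → List ℕ → Set
PartialEmbedding p σ = ∀ i j → i < length σ → j < length σ → compatible p i j (nth σ i) (nth σ j) ≡ 1

partialEmbeddingBit-⌜⌝ : ∀ p σ →
  partialEmbeddingBit p ⌜ σ ⌝ ≡ prodBelow (length σ) (λ i → prodBelow (length σ) (λ j → compatible p i j (nth σ i) (nth σ j)))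
partialEmbeddingBit-⌜⌝ p σ =
  trans (cong (λ l → prodBelow l (λ i → prodBelow l (λ j → compatible p i j (codeNth ⌜ σ ⌝ i) (codeNth ⌜ σ ⌝ j))))
              (codeLength-⌜⌝ σ))
        (prodBelow-cong (λ i → prodBelow-cong (λ j → cong₂ (compatible p i j) (codeNth-⌜⌝ σ i) (codeNth-⌜⌝ σ j))
                                              (length σ))
                        (length σ))

partialEmbeddingBit≡1⇒ : ∀ p σ → partialEmbeddingBit p ⌜ σ ⌝ ≡ 1 → PartialEmbedding p σ
partialEmbeddingBit≡1⇒ p σ bit≡1 i j i<n j<n =
  prodBelow≡1⇒ (length σ) (prodBelow≡1⇒ (length σ) (trans (sym (partialEmbeddingBit-⌜⌝ p σ)) bit≡1) i i<n) j j<n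

partialEmbeddingBit≡1⇐ : ∀ p σ → PartialEmbedding p σ → partialEmbeddingBit p ⌜ σ ⌝ ≡ 1
partialEmbeddingBit≡1⇐ p σ emb = trans (partialEmbeddingBit-⌜⌝ p σ)
  (prodBelow≡1⇐ (length σ) (λ i i<n → prodBelow≡1⇐ (length σ) (λ j j<n → emb i j i<n j<n)))

PartialEmbedding-++⁻ˡ : ∀ p σ τ → PartialEmbedding p (σ ++ τ) → PartialEmbedding p σ
PartialEmbedding-++⁻ˡ p σ τ emb i j i<n j<n =
  subst₂ (λ a b → compatible p i j a b ≡ 1) (nth-++ σ τ i i<n) (nth-++ σ τ j j<n)
         (emb i j (<-≤-trans i<n (length-++-≤ˡ σ)) (<-≤-trans j<n (length-++-≤ˡ σ)))

module EmbeddingTree (p : Baire) where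

  G H : Graph
  G = decodeG (evens p)
  H = decodeG (odds p)

  compatible≡1⇒ : ∀ i j a b → compatible p i j a b ≡ 1 →
    (V H i → V G a) × (V H i → V H j → a ≡ b → i ≡ j) × (E H i j → E G a b)
  compatible≡1⇒ i j a b all≡1 =
    (λ i∈H → vertexBit≡1⇒ (evens p) a (impBit≡1⇒ (vertexBit≤1 (evens p) a) vertices≡1 (eqBit≡1⇐ i∈H))) ,
    (λ i∈H j∈H a≡b → eqBit≡1⇒ i j (impBit≡1⇒ (eqBit≤1 i j) injective≡1
                       (cong₂ _*_ (cong₂ _*_ (eqBit≡1⇐ i∈H) (eqBit≡1⇐ j∈H)) (eqBit≡1⇐ a≡b)))) ,
    (λ ij∈H → edgeBit≡1⇒ (evens p) a b (impBit≡1⇒ (edgeBit≤1 (evens p) a b) edges≡1 (eqBit≡1⇐ ij∈H)))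
    where
    vertices = impBit (vertexBit (odds p) i) (vertexBit (evens p) a)
    injective = impBit (vertexBit (odds p) i * vertexBit (odds p) j * eqBit a b) (eqBit i j)
    edges = impBit (edgeBit (odds p) i j) (edgeBit (evens p) a b)
    vertices≡1 = m*n≡1⇒m≡1 vertices injective (m*n≡1⇒m≡1 (vertices * injective) edges all≡1)
    injective≡1 = m*n≡1⇒n≡1 vertices injective (m*n≡1⇒m≡1 (vertices * injective) edges all≡1)
    edges≡1 = m*n≡1⇒n≡1 (vertices * injective) edges all≡1

  compatible≡1⇐ : ∀ i j a b → (V H i → V G a) → (V H i → V H j → a ≡ b → i ≡ j) → (E H i j → E G a b) →
    compatible p i j a b ≡ 1
  compatible≡1⇐ i j a b vertices injective edges = cong₂ _*_ (cong₂ _*_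
    (impBit≡1⇐ (vertexBit≤1 (odds p) i) (λ i∈H → eqBit≡1⇐ (vertices (vertexBit≡1⇒ (odds p) i i∈H))))
    (impBit≡1⇐ (*-mono-≤ (*-mono-≤ (vertexBit≤1 (odds p) i) (vertexBit≤1 (odds p) j)) (eqBit≤1 a b)) λ premises≡1 →
      let i∈H∧j∈H = m*n≡1⇒m≡1 (vertexBit (odds p) i * vertexBit (odds p) j) (eqBit a b) premises≡1 in
      eqBit≡1⇐ (injective (vertexBit≡1⇒ (odds p) i (m*n≡1⇒m≡1 (vertexBit (odds p) i) (vertexBit (odds p) j) i∈H∧j∈H))
                          (vertexBit≡1⇒ (odds p) j (m*n≡1⇒n≡1 (vertexBit (odds p) i) (vertexBit (odds p) j) i∈H∧j∈H))
                          (eqBit≡1⇒ a b (m*n≡1⇒n≡1 (vertexBit (odds p) i * vertexBit (odds p) j) (eqBit a b) premises≡1)))))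
    (impBit≡1⇐ (edgeBit≤1 (odds p) i j) (λ ij∈H → eqBit≡1⇐ (edges (edgeBit≡1⇒ (odds p) i j ij∈H))))

  T : Baire
  T = fn partialEmbeddingTree p

  isTree : IsTree T
  isTree =
    partialEmbeddingBit≤1 p ,
    (λ σ τ στ∈T → partialEmbeddingBit≡1⇐ p σ
                    (PartialEmbedding-++⁻ˡ p σ τ (partialEmbeddingBit≡1⇒ p (σ ++ τ) στ∈T)))

  path⇒embedding : HasPath T → SubIso H G
  path⇒embedding (f , onPath) =
    f , (λ v → proj₁ (compatible-f v v)) , (λ u v → proj₁ (proj₂ (compatible-f u v))) ,
        (λ u v → proj₂ (proj₂ (compatible-f u v)))
    where
    compatible-f : ∀ u v → _
    compatible-f u v = compatible≡1⇒ u v (f u) (f v)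
      (subst₂ (λ a b → compatible p u v a b ≡ 1) (nth-prefix f m u u<m) (nth-prefix f m v v<m)
              (partialEmbeddingBit≡1⇒ p (prefix f m) (onPath m) u v
                 (subst (u <_) (sym (length-prefix f m)) u<m) (subst (v <_) (sym (length-prefix f m)) v<m)))
      where
      m = suc (u + v)
      u<m = s≤s (m≤m+n u v)
      v<m = s≤s (m≤n+m v u)

  embedding⇒path : SubIso H G → HasPath T
  embedding⇒path (f , f-V , f-inj , f-E) = f , λ m → partialEmbeddingBit≡1⇐ p (prefix f m) λ i j i<n j<n →
    subst₂ (λ a b → compatible p i j a b ≡ 1)
           (sym (nth-prefix f m i (subst (i <_) (length-prefix f m) i<n)))
           (sym (nth-prefix f m j (subst (j <_) (length-prefix f m) j<n)))
           (compatible≡1⇐ i j (f i) (f j) (f-V i) (f-inj i j) (f-E i j))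

S≤sWWF : S ≤sW WF
S≤sWWF = code partialEmbeddingTree , negateHead , λ p _ →
  let open EmbeddingTree p in
  T , code-computes partialEmbeddingTree p , isTree ,
  λ r answer → (λ _ → 1 ∸ r 0) , negateHead-computes r ,
    Answer-swap path⇒embedding (λ ¬path iso → ¬path (embedding⇒path iso)) answer

Child : List ℕ → List ℕ → Set
Child σ τ = length τ ≡ suc (length σ) × (∀ i → i < length σ → nth σ i ≡ nth τ i)

Child-irreflexive : ∀ σ → ¬ Child σ σ
Child-irreflexive σ (|σ|≡1+|σ| , _) = 1+n≢n (sym |σ|≡1+|σ|)

Child-parent-unique : ∀ σ σ′ τ → Child σ τ → Child σ′ τ → σ ≡ σ′
Child-parent-unique σ σ′ τ (|τ|≡1+|σ| , σ≗τ) (|τ|≡1+|σ′| , σ′≗τ) =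
  nth-ext σ σ′ |σ|≡|σ′| (λ i i<n → trans (σ≗τ i i<n) (sym (σ′≗τ i (subst (i <_) |σ|≡|σ′| i<n))))
  where
  |σ|≡|σ′| = suc-injective (trans (sym |τ|≡1+|σ|) |τ|≡1+|σ′|)

prefix-Child : ∀ f m → Child (prefix f m) (prefix f (suc m))
prefix-Child f m =
  trans (length-prefix f (suc m)) (cong suc (sym (length-prefix f m))) ,
  λ i i<n → let i<m = subst (i <_) (length-prefix f m) i<n in
            trans (nth-prefix f m i i<m) (sym (nth-prefix f (suc m) i (m≤n⇒m≤1+n i<m)))

childBit : ℕ → ℕ → ℕ
childBit a b = eqBit (codeLength b) (suc (codeLength a)) * prodBelow (codeLength a) (λ i → eqBit (codeNth a i) (codeNth b i))

childBitᵗ : Tm n → Tm n → Tm n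
childBitᵗ a b = eqBitᵗ (codeLengthᵗ b) (sucᵗ (codeLengthᵗ a))
             *ᵗ prodᵗ (codeLengthᵗ a) (eqBitᵗ (codeNthᵗ (wk a) (var zero)) (codeNthᵗ (wk b) (var zero)))

childBitᵗ-sem : ∀ (a b : Tm n) α ρ → ⟦ childBitᵗ a b ⟧ α ρ ≡ childBit (⟦ a ⟧ α ρ) (⟦ b ⟧ α ρ)
childBitᵗ-sem a b α ρ =
  cong₂ _*_ (cong₂ (λ x y → eqBit x (suc y)) (codeLengthᵗ-sem b α ρ) (codeLengthᵗ-sem a α ρ))
            (trans (prodBelowLengthᵗ-sem a entry α ρ) (prodBelow-cong entry-sem (codeLength (⟦ a ⟧ α ρ))))
  where
  entry = eqBitᵗ (codeNthᵗ (wk a) (var zero)) (codeNthᵗ (wk b) (var zero))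
  nthᵗ-sem : ∀ (c : Tm _) i → ⟦ codeNthᵗ (wk c) (var zero) ⟧ α (i ∷ᵉ ρ) ≡ codeNth (⟦ c ⟧ α ρ) i
  nthᵗ-sem c i = trans (codeNthᵗ-sem (wk c) (var zero) α (i ∷ᵉ ρ)) (cong (λ w → codeNth w i) (wk-sem c α ρ i))
  entry-sem : ∀ i → ⟦ entry ⟧ α (i ∷ᵉ ρ) ≡ eqBit (codeNth (⟦ a ⟧ α ρ) i) (codeNth (⟦ b ⟧ α ρ) i)
  entry-sem i = cong₂ eqBit (nthᵗ-sem a i) (nthᵗ-sem b i)

childBit≤1 : ∀ a b → childBit a b ≤ 1
childBit≤1 a b = *-mono-≤ (eqBit≤1 (codeLength b) (suc (codeLength a)))
                          (prodBelow≤1 (codeLength a) (λ i → eqBit≤1 (codeNth a i) (codeNth b i)))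

childBit-⌜⌝ : ∀ σ τ →
  childBit ⌜ σ ⌝ ⌜ τ ⌝ ≡ eqBit (length τ) (suc (length σ)) * prodBelow (length σ) (λ i → eqBit (nth σ i) (nth τ i))
childBit-⌜⌝ σ τ =
  cong₂ _*_ (cong₂ (λ x y → eqBit x (suc y)) (codeLength-⌜⌝ τ) (codeLength-⌜⌝ σ))
            (trans (cong (λ l → prodBelow l (λ i → eqBit (codeNth ⌜ σ ⌝ i) (codeNth ⌜ τ ⌝ i))) (codeLength-⌜⌝ σ))
                   (prodBelow-cong (λ i → cong₂ eqBit (codeNth-⌜⌝ σ i) (codeNth-⌜⌝ τ i)) (length σ)))

childBit≡1⇒ : ∀ σ τ → childBit ⌜ σ ⌝ ⌜ τ ⌝ ≡ 1 → Child σ τ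
childBit≡1⇒ σ τ bit≡1 =
  eqBit≡1⇒ _ _ (m*n≡1⇒m≡1 lengths prefixes bits≡1) ,
  λ i i<n → eqBit≡1⇒ _ _ (prodBelow≡1⇒ (length σ) (m*n≡1⇒n≡1 lengths prefixes bits≡1) i i<n)
  where
  lengths  = eqBit (length τ) (suc (length σ))
  prefixes = prodBelow (length σ) (λ i → eqBit (nth σ i) (nth τ i))
  bits≡1   = trans (sym (childBit-⌜⌝ σ τ)) bit≡1

childBit≡1⇐ : ∀ σ τ → Child σ τ → childBit ⌜ σ ⌝ ⌜ τ ⌝ ≡ 1
childBit≡1⇐ σ τ (|τ|≡1+|σ| , σ≗τ) =
  trans (childBit-⌜⌝ σ τ)
        (cong₂ _*_ (eqBit≡1⇐ |τ|≡1+|σ|) (prodBelow≡1⇐ (length σ) (λ i i<n → eqBit≡1⇐ (σ≗τ i i<n))))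

childBit≡1⇒Child-decode : ∀ a b → childBit a b ≡ 1 → Child (decode a) (decode b)
childBit≡1⇒Child-decode a b bit≡1 =
  childBit≡1⇒ (decode a) (decode b) (trans (cong₂ childBit (⌜decode⌝ a) (⌜decode⌝ b)) bit≡1)

treeEdgeBit : Baire → ℕ → ℕ
treeEdgeBit T k = eqBit (T (unpair₁ k)) 1 * eqBit (T (unpair₂ k)) 1
                * orBit (childBit (unpair₁ k) (unpair₂ k)) (childBit (unpair₂ k) (unpair₁ k))

treeEdgeBit≤1 : ∀ T k → treeEdgeBit T k ≤ 1
treeEdgeBit≤1 T k = *-mono-≤ (*-mono-≤ (eqBit≤1 (T (unpair₁ k)) 1) (eqBit≤1 (T (unpair₂ k)) 1))
                             (orBit≤1 (childBit (unpair₁ k) (unpair₂ k)) (childBit (unpair₂ k) (unpair₁ k)))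

treeEdgeBit-pair : ∀ T a b → treeEdgeBit T (pair a b) ≡ eqBit (T a) 1 * eqBit (T b) 1 * orBit (childBit a b) (childBit b a)
treeEdgeBit-pair T a b =
  cong₂ (λ x y → eqBit (T x) 1 * eqBit (T y) 1 * orBit (childBit x y) (childBit y x)) (unpair₁-pair a b) (unpair₂-pair a b)

nodes treeEdges treeGraph : Definable
fn       nodes α v     = eqBit (α v) 1
term     nodes u       = eqBitᵗ (oracle u) (lit 1)
term-sem nodes u α ρ   = refl
fn       treeEdges     = treeEdgeBit
term     treeEdges k   = eqBitᵗ (oracle (unpair₁ᵗ k)) (lit 1) *ᵗ eqBitᵗ (oracle (unpair₂ᵗ k)) (lit 1)
                      *ᵗ orBitᵗ (childBitᵗ (unpair₁ᵗ k) (unpair₂ᵗ k)) (childBitᵗ (unpair₂ᵗ k) (unpair₁ᵗ k))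
term-sem treeEdges k α ρ = begin
  eqBit (α x′) 1 * eqBit (α y′) 1 * orBit (⟦ childBitᵗ x y ⟧ α ρ) (⟦ childBitᵗ y x ⟧ α ρ)
    ≡⟨ cong₂ (λ u v → eqBit (α x′) 1 * eqBit (α y′) 1 * orBit u v)
             (childBitᵗ-sem x y α ρ) (childBitᵗ-sem y x α ρ) ⟩
  eqBit (α x′) 1 * eqBit (α y′) 1 * orBit (childBit x′ y′) (childBit y′ x′)
    ≡⟨ cong₂ (λ u v → eqBit (α u) 1 * eqBit (α v) 1 * orBit (childBit u v) (childBit v u))
             (unpair₁ᵗ-sem k α ρ) (unpair₂ᵗ-sem k α ρ) ⟩
  treeEdgeBit α (⟦ k ⟧ α ρ) ∎
  where
  open ≡-Reasoning
  x = unpair₁ᵗ k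
  y = unpair₂ᵗ k
  x′ = ⟦ x ⟧ α ρ
  y′ = ⟦ y ⟧ α ρ
treeGraph = interleave nodes treeEdges

module TreeGraph (T : Baire) where

  Γ : Baire
  Γ = fn treeGraph T

  vertex≡ : ∀ v → evens Γ v ≡ eqBit (T v) 1
  vertex≡ = interleave-even nodes treeEdges T

  edge≡ : ∀ a b → odds Γ (pair a b) ≡ eqBit (T a) 1 * eqBit (T b) 1 * orBit (childBit a b) (childBit b a)
  edge≡ a b = trans (interleave-odd nodes treeEdges T (pair a b)) (treeEdgeBit-pair T a b)

  vertex⇐ : ∀ v → T v ≡ 1 → V (decodeG Γ) v
  vertex⇐ v v∈T = trans (vertex≡ v) (eqBit≡1⇐ v∈T)

  edge⇒ : ∀ a b → E (decodeG Γ) a b → T a ≡ 1 × T b ≡ 1 × (childBit a b ≡ 1 ⊎ childBit b a ≡ 1)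
  edge⇒ a b ab∈Γ =
    eqBit≡1⇒ (T a) 1 (m*n≡1⇒m≡1 (eqBit (T a) 1) (eqBit (T b) 1) nodes≡1) ,
    eqBit≡1⇒ (T b) 1 (m*n≡1⇒n≡1 (eqBit (T a) 1) (eqBit (T b) 1) nodes≡1) ,
    orBit≡1⇒ (childBit≤1 a b) (childBit≤1 b a) (m*n≡1⇒n≡1 (eqBit (T a) 1 * eqBit (T b) 1) related all≡1)
    where
    related = orBit (childBit a b) (childBit b a)
    all≡1   = trans (sym (edge≡ a b)) ab∈Γ
    nodes≡1 = m*n≡1⇒m≡1 (eqBit (T a) 1 * eqBit (T b) 1) related all≡1

  edge⇐ : ∀ a b → T a ≡ 1 → T b ≡ 1 → (childBit a b ≡ 1 ⊎ childBit b a ≡ 1) → E (decodeG Γ) a b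
  edge⇐ a b a∈T b∈T related =
    trans (edge≡ a b) (cong₂ _*_ (cong₂ _*_ (eqBit≡1⇐ a∈T) (eqBit≡1⇐ b∈T)) (orBit≡1⇐ related))

  isGraph : IsGraph Γ
  isGraph =
    interleave-bit nodes treeEdges T (λ v → eqBit≤1 (T v) 1) (treeEdgeBit≤1 T) ,
    (λ a b ab → let (a∈T , b∈T , _) = edge⇒ a b ab in vertex⇐ a a∈T , vertex⇐ b b∈T) ,
    (λ a b ab → let (a∈T , b∈T , related) = edge⇒ a b ab in edge⇐ b a b∈T a∈T (⊎-swap related)) ,
    (λ a aa → let (_ , _ , related) = edge⇒ a a aa in
              Child-irreflexive (decode a) (childBit≡1⇒Child-decode a a (reduce related)))

  module _ (hasPath : HasPath T) where

    ray : ℕ → ℕ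
    ray m = ⌜ prefix (proj₁ hasPath) m ⌝

    ray-embedding : SubIso L (decodeG Γ)
    ray-embedding = ray , (λ v _ → vertex⇐ (ray v) (proj₂ hasPath v)) , injective , edges
      where
      f = proj₁ hasPath
      injective : ∀ u v → _ → _ → ray u ≡ ray v → u ≡ v
      injective u v _ _ ray≡ =
        trans (sym (length-prefix f u)) (trans (cong length (⌜⌝-injective (prefix f u) (prefix f v) ray≡)) (length-prefix f v))
      step : ∀ u → childBit (ray u) (ray (suc u)) ≡ 1
      step u = childBit≡1⇐ (prefix f u) (prefix f (suc u)) (prefix-Child f u)
      edges : ∀ u v → E L u v → E (decodeG Γ) (ray u) (ray v)
      edges u .(suc u) (inj₁ refl) = edge⇐ (ray u) (ray (suc u)) (proj₂ hasPath u) (proj₂ hasPath (suc u)) (inj₁ (step u))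
      edges .(suc v) v (inj₂ refl) = edge⇐ (ray (suc v)) (ray v) (proj₂ hasPath (suc v)) (proj₂ hasPath v) (inj₂ (step v))

-- An injective ray in the graph of T climbs towards the root only finitely often
-- (each climb shortens the node), and after its first descent it never climbs
-- again (that would revisit the unique parent); from there on it runs down a branch.
module RayToPath (T : Baire) (isTree : IsTree T) (f : ℕ → ℕ)
                 (f-injective : ∀ u v → f u ≡ f v → u ≡ v)
                 (f-edges : ∀ k → E (decodeG (TreeGraph.Γ T)) (f k) (f (suc k))) where
  open TreeGraph T

  σ : ℕ → List ℕ
  σ k = decode (f k)

  Down Up : ℕ → Set
  Down k = Child (σ k) (σ (suc k))
  Up   k = Child (σ (suc k)) (σ k)

  down-or-up : ∀ k → Down k ⊎ Up k
  down-or-up k with proj₂ (proj₂ (edge⇒ (f k) (f (suc k)) (f-edges k)))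
  ... | inj₁ down = inj₁ (childBit≡1⇒Child-decode (f k) (f (suc k)) down)
  ... | inj₂ up   = inj₂ (childBit≡1⇒Child-decode (f (suc k)) (f k) up)

  down⇒down : ∀ k → Down k → Down (suc k)
  down⇒down k down with down-or-up (suc k)
  ... | inj₁ down′ = down′
  ... | inj₂ up with f-injective (suc (suc k)) k
                       (decode-injective (f (suc (suc k))) (f k) (Child-parent-unique _ _ (σ (suc k)) up down))
  ...   | ()

  eventually-down : ∀ d k → length (σ k) ≡ d → Σ ℕ Down
  eventually-down d k |σk|≡d with down-or-up k
  ... | inj₁ down = k , down
  eventually-down zero    k |σk|≡0   | inj₂ (|σk|≡1+ , _) with trans (sym |σk|≡1+) |σk|≡0
  ... | ()
  eventually-down (suc d) k |σk|≡1+d | inj₂ (|σk|≡1+ , _) =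
    eventually-down d (suc k) (suc-injective (trans (sym |σk|≡1+) |σk|≡1+d))

  k₀ : ℕ
  k₀ = proj₁ (eventually-down (length (σ 0)) 0 refl)

  down-after-k₀ : ∀ j → Down (k₀ + j)
  down-after-k₀ zero    = subst Down (sym (+-identityʳ k₀)) (proj₂ (eventually-down (length (σ 0)) 0 refl))
  down-after-k₀ (suc j) = subst Down (sym (+-suc k₀ j)) (down⇒down _ (down-after-k₀ j))

  τ : ℕ → List ℕ
  τ j = σ (k₀ + j)

  τ-Child : ∀ j → Child (τ j) (τ (suc j))
  τ-Child j = subst (λ k → Child (τ j) (σ k)) (sym (+-suc k₀ j)) (down-after-k₀ j)

  length-τ : ∀ j → length (τ j) ≡ length (τ 0) + j
  length-τ zero    = sym (+-identityʳ (length (τ 0)))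
  length-τ (suc j) = trans (proj₁ (τ-Child j)) (trans (cong suc (length-τ j)) (sym (+-suc (length (τ 0)) j)))

  j≤length-τ : ∀ j → j ≤ length (τ j)
  j≤length-τ j = subst (j ≤_) (sym (length-τ j)) (m≤n+m j (length (τ 0)))

  length-τ-mono : ∀ j d → length (τ j) ≤ length (τ (j + d))
  length-τ-mono j d = subst₂ _≤_ (sym (length-τ j)) (sym (length-τ (j + d))) (+-monoʳ-≤ (length (τ 0)) (m≤m+n j d))

  τ-extends : ∀ j d i → i < length (τ j) → nth (τ j) i ≡ nth (τ (j + d)) i
  τ-extends j zero    i i<n = cong (λ k → nth (τ k) i) (sym (+-identityʳ j))
  τ-extends j (suc d) i i<n = trans (τ-extends j d i i<n)
    (trans (proj₂ (τ-Child (j + d)) i (<-≤-trans i<n (length-τ-mono j d))) (cong (λ k → nth (τ k) i) (sym (+-suc j d))))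

  branch : ℕ → ℕ
  branch i = nth (τ (suc i)) i

  prefix-branch : ∀ m → prefix branch m ≡ take m (τ m)
  prefix-branch m = nth-ext (prefix branch m) (take m (τ m))
    (trans (length-prefix branch m) (sym (trans (length-take m (τ m)) (m≤n⇒m⊓n≡m (j≤length-τ m)))))
    (λ i i<n → nth-branch i (subst (i <_) (length-prefix branch m) i<n))
    where
    nth-branch : ∀ i → i < m → nth (prefix branch m) i ≡ nth (take m (τ m)) i
    nth-branch i i<m = begin
      nth (prefix branch m) i          ≡⟨ nth-prefix branch m i i<m ⟩
      nth (τ (suc i)) i                ≡⟨ τ-extends (suc i) (m ∸ suc i) i (<-≤-trans (n<1+n i) (j≤length-τ (suc i))) ⟩
      nth (τ (suc i + (m ∸ suc i))) i  ≡⟨ cong (λ k → nth (τ k) i) (m+[n∸m]≡n i<m) ⟩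
      nth (τ m) i                      ≡⟨ nth-take m (τ m) i i<m ⟨
      nth (take m (τ m)) i             ∎ where open ≡-Reasoning

  τ∈T : ∀ j → τ j ∈T T
  τ∈T j = trans (cong T (⌜decode⌝ (f (k₀ + j)))) (proj₁ (edge⇒ (f (k₀ + j)) (f (suc (k₀ + j))) (f-edges (k₀ + j))))

  path : HasPath T
  path = branch , λ m → subst (_∈T T) (sym (prefix-branch m))
    (proj₂ isTree (take m (τ m)) (drop m (τ m)) (subst (_∈T T) (sym (take++drop≡id m (τ m))) (τ∈T m)))

embedding⇒path : ∀ T → IsTree T → SubIso L (decodeG (TreeGraph.Γ T)) → HasPath T
embedding⇒path T isTree (f , _ , f-injective , f-edges) =
  RayToPath.path T isTree f (λ u v → f-injective u v tt tt) (λ k → f-edges k (suc k) (inj₁ refl))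

WF≤sWSL : WF ≤sW SL
WF≤sWSL = code treeGraph , negateHead , λ T isTree →
  let open TreeGraph T in
  Γ , code-computes treeGraph T , isGraph ,
  λ r answer → (λ _ → 1 ∸ r 0) , negateHead-computes r ,
    Answer-swap (λ ¬embedding hasPath → ¬embedding (ray-embedding hasPath)) (embedding⇒path T isTree) answer

theorem25 : (WF ≡sW SL) × (SL ≡sW S)
theorem25 = (WF≤sWSL , ≤sW-trans SL≤sWS S≤sWWF) , (SL≤sWS , ≤sW-trans S≤sWWF WF≤sWSL)
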